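{- Given a filtered category $\mathcal{I}$ and a functor $A:\mathcal{I}\to\mathbf{rGSet}$ with colimit $A^\infty$, the canonical map $\varinjlim_i T_1(A(i))\to T_1(A^\infty)$ is an isomorphism of reflexive globular sets, i.e. $T_1(A^\infty)\cong\varinjlim_i T_1(A(i))$.
   Context: $\mathbf{rGSet}$ is the category of reflexive globular sets (sets $G_n$ with $s,t:G_{n+1}\to G_n$, $i:G_n\to G_{n+1}$, $ss=st$, $ts=tt$, $si=ti=\mathrm{id}$). $\mathbb{T}_1$ is intensional Martin-Löf type theory (dependent products, dependent sums without $\eta$, identity types with $\mathrm{r}$ and $J$, natural numbers) plus the rule: from $p:\mathrm{Id}_{\mathrm{Id}_A(a_1,b_1)}(a_2,b_2)$ infer $a_2=b_2$. $\mathbb{T}_1[G]$ adds a basic type $\ulcorner G\urcorner$, a basic closed term for each cell of $G$ in the iterated identity type on $\ulcorner G\urcorner$ given by its iterated sources/targets, and conversions $\ulcorner i(\alpha)\urcorner=\mathrm{r}(\ulcorner\alpha\urcorner)$. $T_1(G)$ is the reflexive globular set with $0$-cells the closed terms of type $\ulcorner G\urcorner$ in $\mathbb{T}_1[G]$ (modulo definitional equality) and $(n{+}1)$-cells tuples $(\vec\alpha;\beta_0,\beta_1;\gamma)$ with $(\vec\alpha;\beta_k)$ $n$-cells and $\gamma$ a closed term of the identity type between $\beta_0,\beta_1$; a map $\varphi:G\to H$ acts by renaming basic terms $\ulcorner g\urcorner\mapsto\ulcorner\varphi(g)\urcorner$. -}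

module Defs where

open import Data.Nat using (ℕ; zero; suc)
open import Data.Fin using (Fin; zero; suc)
open import Data.Product using (Σ; _×_; _,_; proj₁; proj₂; Σ-syntax)
open import Function using (_∘_)
open import Relation.Binary.PropositionalEquality hiding (isEquivalence; J)
import Relation.Binary.PropositionalEquality as P
open import Relation.Binary.Structures using (IsEquivalence)

record RGSet : Set₁ where
  field
    Cell : ℕ → Set
    s t : ∀ {n} → Cell (suc n) → Cell n
    i : ∀ {n} → Cell n → Cell (suc n)
    ss≡st : ∀ {n} (x : Cell (suc (suc n))) → s (s x) ≡ s (t x)
    ts≡tt : ∀ {n} (x : Cell (suc (suc n))) → t (s x) ≡ t (t x)
    si≡id : ∀ {n} (x : Cell n) → s (i x) ≡ x
    ti≡id : ∀ {n} (x : Cell n) → t (i x) ≡ x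

record RGHom (G H : RGSet) : Set where
  private
    module G = RGSet G
    module H = RGSet H
  field
    fun : ∀ {n} → G.Cell n → H.Cell n
    fun-s : ∀ {n} (x : G.Cell (suc n)) → fun (G.s x) ≡ H.s (fun x)
    fun-t : ∀ {n} (x : G.Cell (suc n)) → fun (G.t x) ≡ H.t (fun x)
    fun-i : ∀ {n} (x : G.Cell n) → fun (G.i x) ≡ H.i (fun x)

-- Setoid-valued reflexive globular sets: reflexive globular sets whose
-- sets of cells are given as setoids (needed since T₁(G) is a quotient
-- of syntax by definitional equality, and Agda has no quotient types).

record SRGSet : Set₁ where
  field
    Cell : ℕ → Set
    _≈_ : ∀ {n} → Cell n → Cell n → Set
    isEquivalence : ∀ {n} → IsEquivalence (_≈_ {n})
    s t : ∀ {n} → Cell (suc n) → Cell n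
    i : ∀ {n} → Cell n → Cell (suc n)
    s-cong : ∀ {n} {x y : Cell (suc n)} → x ≈ y → s x ≈ s y
    t-cong : ∀ {n} {x y : Cell (suc n)} → x ≈ y → t x ≈ t y
    i-cong : ∀ {n} {x y : Cell n} → x ≈ y → i x ≈ i y
    ss≈st : ∀ {n} (x : Cell (suc (suc n))) → s (s x) ≈ s (t x)
    ts≈tt : ∀ {n} (x : Cell (suc (suc n))) → t (s x) ≈ t (t x)
    si≈id : ∀ {n} (x : Cell n) → s (i x) ≈ x
    ti≈id : ∀ {n} (x : Cell n) → t (i x) ≈ x

record SRGHom (X Y : SRGSet) : Set where
  private
    module X = SRGSet X
    module Y = SRGSet Y
  field
    fun : ∀ {n} → X.Cell n → Y.Cell n
    fun-cong : ∀ {n} {x y : X.Cell n} → x X.≈ y → fun x Y.≈ fun y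
    fun-s : ∀ {n} (x : X.Cell (suc n)) → fun (X.s x) Y.≈ Y.s (fun x)
    fun-t : ∀ {n} (x : X.Cell (suc n)) → fun (X.t x) Y.≈ Y.t (fun x)
    fun-i : ∀ {n} (x : X.Cell n) → fun (X.i x) Y.≈ Y.i (fun x)

disc : RGSet → SRGSet
disc G = record
  { Cell = Cell ; _≈_ = _≡_ ; isEquivalence = P.isEquivalence
  ; s = s ; t = t ; i = i
  ; s-cong = cong s ; t-cong = cong t ; i-cong = cong i
  ; ss≈st = ss≡st ; ts≈tt = ts≡tt ; si≈id = si≡id ; ti≈id = ti≡id }
  where open RGSet G

discHom : ∀ {G H} → RGHom G H → SRGHom (disc G) (disc H)
discHom φ = record { fun = fun ; fun-cong = cong fun ; fun-s = fun-s ; fun-t = fun-t ; fun-i = fun-i }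
  where open RGHom φ

record Category : Set₁ where
  infixr 9 _∘c_
  field
    Obj : Set
    Hom : Obj → Obj → Set
    idc : ∀ {a} → Hom a a
    _∘c_ : ∀ {a b c} → Hom b c → Hom a b → Hom a c
    identityˡ : ∀ {a b} (f : Hom a b) → idc ∘c f ≡ f
    identityʳ : ∀ {a b} (f : Hom a b) → f ∘c idc ≡ f
    assoc : ∀ {a b c d} (h : Hom c d) (g : Hom b c) (f : Hom a b) →
            (h ∘c g) ∘c f ≡ h ∘c (g ∘c f)

record IsFiltered (𝒞 : Category) : Set where
  open Category 𝒞
  field
    nonempty : Obj
    upper-bound : ∀ a b → Σ[ c ∈ Obj ] (Hom a c × Hom b c)
    coequalise : ∀ {a b} (f g : Hom a b) →
                 Σ[ c ∈ Obj ] Σ[ h ∈ Hom b c ] (h ∘c f ≡ h ∘c g)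

record Functor (𝒞 : Category) : Set₁ where
  open Category 𝒞
  field
    obj : Obj → RGSet
    hom : ∀ {a b} → Hom a b → RGHom (obj a) (obj b)
    hom-id : ∀ {a n} (x : RGSet.Cell (obj a) n) → RGHom.fun (hom (idc {a})) x ≡ x
    hom-∘ : ∀ {a b c} (g : Hom b c) (f : Hom a b) {n} (x : RGSet.Cell (obj a) n) →
            RGHom.fun (hom (g ∘c f)) x ≡ RGHom.fun (hom g) (RGHom.fun (hom f) x)

record IsColimit (𝒞 : Category) (D : Category.Obj 𝒞 → SRGSet)
                 (Dhom : ∀ {a b} → Category.Hom 𝒞 a b → SRGHom (D a) (D b))
                 (X : SRGSet) (ℓ : ∀ a → SRGHom (D a) X) : Set₁ where
  open Category 𝒞
  private module X = SRGSet X
  field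
    commutes : ∀ {a b} (f : Hom a b) {n} (x : SRGSet.Cell (D a) n) →
               SRGHom.fun (ℓ b) (SRGHom.fun (Dhom f) x) X.≈ SRGHom.fun (ℓ a) x
    universal : (Y : SRGSet) (μ : ∀ a → SRGHom (D a) Y) →
      (∀ {a b} (f : Hom a b) {n} (x : SRGSet.Cell (D a) n) →
         SRGSet._≈_ Y (SRGHom.fun (μ b) (SRGHom.fun (Dhom f) x)) (SRGHom.fun (μ a) x)) →
      Σ[ m ∈ SRGHom X Y ]
        ((∀ a {n} (x : SRGSet.Cell (D a) n) →
            SRGSet._≈_ Y (SRGHom.fun m (SRGHom.fun (ℓ a) x)) (SRGHom.fun (μ a) x))
        × ((m′ : SRGHom X Y) →
           (∀ a {n} (x : SRGSet.Cell (D a) n) →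
              SRGSet._≈_ Y (SRGHom.fun m′ (SRGHom.fun (ℓ a) x)) (SRGHom.fun (μ a) x)) →
           ∀ {n} (x : X.Cell n) → SRGSet._≈_ Y (SRGHom.fun m′ x) (SRGHom.fun m x)))

-- Raw syntax of 𝕋₁[G] (de Bruijn indices; n = number of free variables)

module _ (G : RGSet) where
  open RGSet G

  mutual
    data Ty (n : ℕ) : Set where
      `G : Ty n
      `ℕ : Ty n
      `Π : Ty n → Ty (suc n) → Ty n
      `Σ : Ty n → Ty (suc n) → Ty n
      `Id : Ty n → Tm n → Tm n → Ty n

    data Tm (n : ℕ) : Set where
      var : Fin n → Tm n
      lam : Tm (suc n) → Tm n
      app : Tm n → Tm n → Tm n
      pair : Tm n → Tm n → Tm n
      split : Ty (suc n) → Tm (suc (suc n)) → Tm n → Tm n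
      rfl : Tm n → Tm n
      J : Ty (suc (suc (suc n))) → Tm (suc n) → Tm n → Tm n → Tm n → Tm n
      ze : Tm n
      su : Tm n → Tm n
      natrec : Ty (suc n) → Tm n → Tm (suc (suc n)) → Tm n → Tm n
      const : ∀ {k} → Cell k → Tm n

Ren : ℕ → ℕ → Set
Ren m n = Fin m → Fin n

liftR : ∀ {m n} → Ren m n → Ren (suc m) (suc n)
liftR ρ zero = zero
liftR ρ (suc x) = suc (ρ x)

module _ {G : RGSet} where
  mutual
    renTy : ∀ {m n} → Ren m n → Ty G m → Ty G n
    renTy ρ `G = `G
    renTy ρ `ℕ = `ℕ
    renTy ρ (`Π A B) = `Π (renTy ρ A) (renTy (liftR ρ) B)
    renTy ρ (`Σ A B) = `Σ (renTy ρ A) (renTy (liftR ρ) B)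
    renTy ρ (`Id A a b) = `Id (renTy ρ A) (renTm ρ a) (renTm ρ b)

    renTm : ∀ {m n} → Ren m n → Tm G m → Tm G n
    renTm ρ (var x) = var (ρ x)
    renTm ρ (lam b) = lam (renTm (liftR ρ) b)
    renTm ρ (app f a) = app (renTm ρ f) (renTm ρ a)
    renTm ρ (pair a b) = pair (renTm ρ a) (renTm ρ b)
    renTm ρ (split C c p) = split (renTy (liftR ρ) C) (renTm (liftR (liftR ρ)) c) (renTm ρ p)
    renTm ρ (rfl a) = rfl (renTm ρ a)
    renTm ρ (J C d a b p) = J (renTy (liftR (liftR (liftR ρ))) C) (renTm (liftR ρ) d)
                              (renTm ρ a) (renTm ρ b) (renTm ρ p)
    renTm ρ ze = ze
    renTm ρ (su a) = su (renTm ρ a)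
    renTm ρ (natrec C z c a) = natrec (renTy (liftR ρ) C) (renTm ρ z)
                                 (renTm (liftR (liftR ρ)) c) (renTm ρ a)
    renTm ρ (const α) = const α

  wkTy : ∀ {n} → Ty G n → Ty G (suc n)
  wkTy = renTy suc

  wkTm : ∀ {n} → Tm G n → Tm G (suc n)
  wkTm = renTm suc

  Sub : ℕ → ℕ → Set
  Sub m n = Fin m → Tm G n

  liftS : ∀ {m n} → Sub m n → Sub (suc m) (suc n)
  liftS σ zero = var zero
  liftS σ (suc x) = wkTm (σ x)

  mutual
    subTy : ∀ {m n} → Sub m n → Ty G m → Ty G n
    subTy σ `G = `G
    subTy σ `ℕ = `ℕ
    subTy σ (`Π A B) = `Π (subTy σ A) (subTy (liftS σ) B)
    subTy σ (`Σ A B) = `Σ (subTy σ A) (subTy (liftS σ) B)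
    subTy σ (`Id A a b) = `Id (subTy σ A) (subTm σ a) (subTm σ b)

    subTm : ∀ {m n} → Sub m n → Tm G m → Tm G n
    subTm σ (var x) = σ x
    subTm σ (lam b) = lam (subTm (liftS σ) b)
    subTm σ (app f a) = app (subTm σ f) (subTm σ a)
    subTm σ (pair a b) = pair (subTm σ a) (subTm σ b)
    subTm σ (split C c p) = split (subTy (liftS σ) C) (subTm (liftS (liftS σ)) c) (subTm σ p)
    subTm σ (rfl a) = rfl (subTm σ a)
    subTm σ (J C d a b p) = J (subTy (liftS (liftS (liftS σ))) C) (subTm (liftS σ) d)
                              (subTm σ a) (subTm σ b) (subTm σ p)
    subTm σ ze = ze
    subTm σ (su a) = su (subTm σ a)
    subTm σ (natrec C z c a) = natrec (subTy (liftS σ) C) (subTm σ z)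
                                 (subTm (liftS (liftS σ)) c) (subTm σ a)
    subTm σ (const α) = const α

  idS : ∀ {n} → Sub n n
  idS = var

  wkS : ∀ {n} → Sub n (suc n)
  wkS x = var (suc x)

  wk2S : ∀ {n} → Sub n (suc (suc n))
  wk2S x = var (suc (suc x))

  infixl 5 _∷ₛ_
  _∷ₛ_ : ∀ {m n} → Sub m n → Tm G n → Sub (suc m) n
  (σ ∷ₛ a) zero = a
  (σ ∷ₛ a) (suc x) = σ x

  _[_]₀ : ∀ {n} → Ty G (suc n) → Tm G n → Ty G n
  B [ a ]₀ = subTy (idS ∷ₛ a) B

module _ (G : RGSet) where
  open RGSet G

  infixl 6 _▸_
  data Ctx : ℕ → Set where
    ε : Ctx zero
    _▸_ : ∀ {n} → Ctx n → Ty G n → Ctx (suc n)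

  lookup : ∀ {n} → Ctx n → Fin n → Ty G n
  lookup (Γ ▸ A) zero = wkTy A
  lookup (Γ ▸ A) (suc x) = wkTy (lookup Γ x)

  cellTy : ∀ {n k} → Cell k → Ty G n
  cellTy {k = zero} α = `G
  cellTy {k = suc k} α = `Id (cellTy (s α)) (const (s α)) (const (t α))

module _ {G : RGSet} where
  open RGSet G
  infix 4 ⊢_ _⊢Ty_ _⊢_≣Ty_ _⊢_∶_ _⊢_≣_∶_

  mutual
    data ⊢_ : ∀ {n} → Ctx G n → Set where
      ⊢ε : ⊢ ε
      ⊢▸ : ∀ {n} {Γ : Ctx G n} {A} → ⊢ Γ → Γ ⊢Ty A → ⊢ Γ ▸ A

    data _⊢Ty_ {n} (Γ : Ctx G n) : Ty G n → Set where
      G-F : ⊢ Γ → Γ ⊢Ty `G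
      ℕ-F : ⊢ Γ → Γ ⊢Ty `ℕ
      Π-F : ∀ {A B} → Γ ⊢Ty A → Γ ▸ A ⊢Ty B → Γ ⊢Ty `Π A B
      Σ-F : ∀ {A B} → Γ ⊢Ty A → Γ ▸ A ⊢Ty B → Γ ⊢Ty `Σ A B
      Id-F : ∀ {A a b} → Γ ⊢Ty A → Γ ⊢ a ∶ A → Γ ⊢ b ∶ A → Γ ⊢Ty `Id A a b

    data _⊢_≣Ty_ {n} (Γ : Ctx G n) : Ty G n → Ty G n → Set where
      ty-refl : ∀ {A} → Γ ⊢Ty A → Γ ⊢ A ≣Ty A
      ty-sym : ∀ {A B} → Γ ⊢ A ≣Ty B → Γ ⊢ B ≣Ty A
      ty-trans : ∀ {A B C} → Γ ⊢ A ≣Ty B → Γ ⊢ B ≣Ty C → Γ ⊢ A ≣Ty C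
      Π-cong : ∀ {A A′ B B′} → Γ ⊢Ty A → Γ ⊢ A ≣Ty A′ → Γ ▸ A ⊢ B ≣Ty B′ →
               Γ ⊢ `Π A B ≣Ty `Π A′ B′
      Σ-cong : ∀ {A A′ B B′} → Γ ⊢Ty A → Γ ⊢ A ≣Ty A′ → Γ ▸ A ⊢ B ≣Ty B′ →
               Γ ⊢ `Σ A B ≣Ty `Σ A′ B′
      Id-cong : ∀ {A A′ a a′ b b′} → Γ ⊢ A ≣Ty A′ → Γ ⊢ a ≣ a′ ∶ A → Γ ⊢ b ≣ b′ ∶ A →
                Γ ⊢ `Id A a b ≣Ty `Id A′ a′ b′

    data _⊢_∶_ {n} (Γ : Ctx G n) : Tm G n → Ty G n → Set where
      var : ⊢ Γ → (x : Fin n) → Γ ⊢ var x ∶ lookup G Γ x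
      conv : ∀ {a A B} → Γ ⊢ a ∶ A → Γ ⊢ A ≣Ty B → Γ ⊢ a ∶ B
      lam : ∀ {A B b} → Γ ⊢Ty A → Γ ▸ A ⊢ b ∶ B → Γ ⊢ lam b ∶ `Π A B
      app : ∀ {A B f a} → Γ ⊢ f ∶ `Π A B → Γ ⊢ a ∶ A → Γ ⊢ app f a ∶ B [ a ]₀
      pair : ∀ {A B a b} → Γ ⊢Ty A → Γ ▸ A ⊢Ty B → Γ ⊢ a ∶ A → Γ ⊢ b ∶ B [ a ]₀ →
             Γ ⊢ pair a b ∶ `Σ A B
      split : ∀ {A B C c p} → Γ ▸ `Σ A B ⊢Ty C →
              Γ ▸ A ▸ B ⊢ c ∶ subTy (wk2S ∷ₛ pair (var (suc zero)) (var zero)) C →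
              Γ ⊢ p ∶ `Σ A B → Γ ⊢ split C c p ∶ C [ p ]₀
      rfl : ∀ {A a} → Γ ⊢ a ∶ A → Γ ⊢ rfl a ∶ `Id A a a
      J : ∀ {A C d a b p} →
          Γ ▸ A ▸ wkTy A ▸ `Id (wkTy (wkTy A)) (var (suc zero)) (var zero) ⊢Ty C →
          Γ ▸ A ⊢ d ∶ subTy (wkS ∷ₛ var zero ∷ₛ var zero ∷ₛ rfl (var zero)) C →
          Γ ⊢ a ∶ A → Γ ⊢ b ∶ A → Γ ⊢ p ∶ `Id A a b →
          Γ ⊢ J C d a b p ∶ subTy (idS ∷ₛ a ∷ₛ b ∷ₛ p) C
      ze : ⊢ Γ → Γ ⊢ ze ∶ `ℕ
      su : ∀ {a} → Γ ⊢ a ∶ `ℕ → Γ ⊢ su a ∶ `ℕ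
      natrec : ∀ {C z c a} → Γ ▸ `ℕ ⊢Ty C → Γ ⊢ z ∶ C [ ze ]₀ →
               Γ ▸ `ℕ ▸ C ⊢ c ∶ subTy (wk2S ∷ₛ su (var (suc zero))) C →
               Γ ⊢ a ∶ `ℕ → Γ ⊢ natrec C z c a ∶ C [ a ]₀
      const : ⊢ Γ → ∀ {k} (α : Cell k) → Γ ⊢ const α ∶ cellTy G α

    data _⊢_≣_∶_ {n} (Γ : Ctx G n) : Tm G n → Tm G n → Ty G n → Set where
      tm-refl : ∀ {a A} → Γ ⊢ a ∶ A → Γ ⊢ a ≣ a ∶ A
      tm-sym : ∀ {a b A} → Γ ⊢ a ≣ b ∶ A → Γ ⊢ b ≣ a ∶ A
      tm-trans : ∀ {a b c A} → Γ ⊢ a ≣ b ∶ A → Γ ⊢ b ≣ c ∶ A → Γ ⊢ a ≣ c ∶ A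
      conv : ∀ {a b A B} → Γ ⊢ a ≣ b ∶ A → Γ ⊢ A ≣Ty B → Γ ⊢ a ≣ b ∶ B
      lam-cong : ∀ {A B b b′} → Γ ⊢Ty A → Γ ▸ A ⊢ b ≣ b′ ∶ B → Γ ⊢ lam b ≣ lam b′ ∶ `Π A B
      app-cong : ∀ {A B f f′ a a′} → Γ ⊢ f ≣ f′ ∶ `Π A B → Γ ⊢ a ≣ a′ ∶ A →
                 Γ ⊢ app f a ≣ app f′ a′ ∶ B [ a ]₀
      pair-cong : ∀ {A B a a′ b b′} → Γ ⊢Ty A → Γ ▸ A ⊢Ty B → Γ ⊢ a ≣ a′ ∶ A →
                  Γ ⊢ b ≣ b′ ∶ B [ a ]₀ → Γ ⊢ pair a b ≣ pair a′ b′ ∶ `Σ A B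
      split-cong : ∀ {A B C C′ c c′ p p′} → Γ ▸ `Σ A B ⊢ C ≣Ty C′ →
                   Γ ▸ A ▸ B ⊢ c ≣ c′ ∶ subTy (wk2S ∷ₛ pair (var (suc zero)) (var zero)) C →
                   Γ ⊢ p ≣ p′ ∶ `Σ A B → Γ ⊢ split C c p ≣ split C′ c′ p′ ∶ C [ p ]₀
      rfl-cong : ∀ {A a a′} → Γ ⊢ a ≣ a′ ∶ A → Γ ⊢ rfl a ≣ rfl a′ ∶ `Id A a a
      J-cong : ∀ {A C C′ d d′ a a′ b b′ p p′} →
               Γ ▸ A ▸ wkTy A ▸ `Id (wkTy (wkTy A)) (var (suc zero)) (var zero) ⊢ C ≣Ty C′ →
               Γ ▸ A ⊢ d ≣ d′ ∶ subTy (wkS ∷ₛ var zero ∷ₛ var zero ∷ₛ rfl (var zero)) C →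
               Γ ⊢ a ≣ a′ ∶ A → Γ ⊢ b ≣ b′ ∶ A → Γ ⊢ p ≣ p′ ∶ `Id A a b →
               Γ ⊢ J C d a b p ≣ J C′ d′ a′ b′ p′ ∶ subTy (idS ∷ₛ a ∷ₛ b ∷ₛ p) C
      su-cong : ∀ {a a′} → Γ ⊢ a ≣ a′ ∶ `ℕ → Γ ⊢ su a ≣ su a′ ∶ `ℕ
      natrec-cong : ∀ {C C′ z z′ c c′ a a′} → Γ ▸ `ℕ ⊢ C ≣Ty C′ → Γ ⊢ z ≣ z′ ∶ C [ ze ]₀ →
                    Γ ▸ `ℕ ▸ C ⊢ c ≣ c′ ∶ subTy (wk2S ∷ₛ su (var (suc zero))) C →
                    Γ ⊢ a ≣ a′ ∶ `ℕ → Γ ⊢ natrec C z c a ≣ natrec C′ z′ c′ a′ ∶ C [ a ]₀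
      Π-β : ∀ {A B b a} → Γ ⊢Ty A → Γ ▸ A ⊢ b ∶ B → Γ ⊢ a ∶ A →
            Γ ⊢ app (lam b) a ≣ subTm (idS ∷ₛ a) b ∶ B [ a ]₀
      Π-η : ∀ {A B f} → Γ ⊢ f ∶ `Π A B →
            Γ ⊢ f ≣ lam (app (wkTm f) (var zero)) ∶ `Π A B
      Σ-β : ∀ {A B C c a b} → Γ ▸ A ⊢Ty B → Γ ▸ `Σ A B ⊢Ty C →
            Γ ▸ A ▸ B ⊢ c ∶ subTy (wk2S ∷ₛ pair (var (suc zero)) (var zero)) C →
            Γ ⊢ a ∶ A → Γ ⊢ b ∶ B [ a ]₀ →
            Γ ⊢ split C c (pair a b) ≣ subTm (idS ∷ₛ a ∷ₛ b) c ∶ C [ pair a b ]₀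
      J-β : ∀ {A C d a} →
            Γ ▸ A ▸ wkTy A ▸ `Id (wkTy (wkTy A)) (var (suc zero)) (var zero) ⊢Ty C →
            Γ ▸ A ⊢ d ∶ subTy (wkS ∷ₛ var zero ∷ₛ var zero ∷ₛ rfl (var zero)) C →
            Γ ⊢ a ∶ A →
            Γ ⊢ J C d a a (rfl a) ≣ subTm (idS ∷ₛ a) d ∶ subTy (idS ∷ₛ a ∷ₛ a ∷ₛ rfl a) C
      ℕ-β-ze : ∀ {C z c} → Γ ▸ `ℕ ⊢Ty C → Γ ⊢ z ∶ C [ ze ]₀ →
               Γ ▸ `ℕ ▸ C ⊢ c ∶ subTy (wk2S ∷ₛ su (var (suc zero))) C →
               Γ ⊢ natrec C z c ze ≣ z ∶ C [ ze ]₀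
      ℕ-β-su : ∀ {C z c a} → Γ ▸ `ℕ ⊢Ty C → Γ ⊢ z ∶ C [ ze ]₀ →
               Γ ▸ `ℕ ▸ C ⊢ c ∶ subTy (wk2S ∷ₛ su (var (suc zero))) C →
               Γ ⊢ a ∶ `ℕ →
               Γ ⊢ natrec C z c (su a) ≣ subTm (idS ∷ₛ a ∷ₛ natrec C z c a) c ∶ C [ su a ]₀
      -- the extra rule of 𝕋₁: from p : Id_{Id_A(a₁,b₁)}(a₂,b₂) infer a₂ = b₂
      Id-reflect : ∀ {A a₁ b₁ a₂ b₂ p} → Γ ⊢ p ∶ `Id (`Id A a₁ b₁) a₂ b₂ →
                   Γ ⊢ a₂ ≣ b₂ ∶ `Id A a₁ b₁
      const-i : ⊢ Γ → ∀ {k} (α : Cell k) → Γ ⊢ const (i α) ≣ rfl (const α) ∶ cellTy G (i α)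

module _ {G H : RGSet} (φ : RGHom G H) where
  open RGHom φ

  mutual
    mapTy : ∀ {n} → Ty G n → Ty H n
    mapTy `G = `G
    mapTy `ℕ = `ℕ
    mapTy (`Π A B) = `Π (mapTy A) (mapTy B)
    mapTy (`Σ A B) = `Σ (mapTy A) (mapTy B)
    mapTy (`Id A a b) = `Id (mapTy A) (mapTm a) (mapTm b)

    mapTm : ∀ {n} → Tm G n → Tm H n
    mapTm (var x) = var x
    mapTm (lam b) = lam (mapTm b)
    mapTm (app f a) = app (mapTm f) (mapTm a)
    mapTm (pair a b) = pair (mapTm a) (mapTm b)
    mapTm (split C c p) = split (mapTy C) (mapTm c) (mapTm p)
    mapTm (rfl a) = rfl (mapTm a)
    mapTm (J C d a b p) = J (mapTy C) (mapTm d) (mapTm a) (mapTm b) (mapTm p)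
    mapTm ze = ze
    mapTm (su a) = su (mapTm a)
    mapTm (natrec C z c a) = natrec (mapTy C) (mapTm z) (mapTm c) (mapTm a)
    mapTm (const α) = const (fun α)

  mapCtx : ∀ {n} → Ctx G n → Ctx H n
  mapCtx ε = ε
  mapCtx (Γ ▸ A) = mapCtx Γ ▸ mapTy A

  mutual
    map-renTy : ∀ {m n} (ρ : Ren m n) (A : Ty G m) → mapTy (renTy ρ A) ≡ renTy ρ (mapTy A)
    map-renTy ρ `G = refl
    map-renTy ρ `ℕ = refl
    map-renTy ρ (`Π A B) = cong₂ `Π (map-renTy ρ A) (map-renTy (liftR ρ) B)
    map-renTy ρ (`Σ A B) = cong₂ `Σ (map-renTy ρ A) (map-renTy (liftR ρ) B)
    map-renTy ρ (`Id A a b) =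
      cong₂ (λ X (y : Tm H _ × Tm H _) → `Id X (proj₁ y) (proj₂ y))
            (map-renTy ρ A) (cong₂ _,_ (map-renTm ρ a) (map-renTm ρ b))

    map-renTm : ∀ {m n} (ρ : Ren m n) (a : Tm G m) → mapTm (renTm ρ a) ≡ renTm ρ (mapTm a)
    map-renTm ρ (var x) = refl
    map-renTm ρ (lam b) = cong lam (map-renTm (liftR ρ) b)
    map-renTm ρ (app f a) = cong₂ app (map-renTm ρ f) (map-renTm ρ a)
    map-renTm ρ (pair a b) = cong₂ pair (map-renTm ρ a) (map-renTm ρ b)
    map-renTm ρ (split C c p)
      rewrite map-renTy (liftR ρ) C | map-renTm (liftR (liftR ρ)) c | map-renTm ρ p = refl
    map-renTm ρ (rfl a) = cong rfl (map-renTm ρ a)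
    map-renTm ρ (J C d a b p)
      rewrite map-renTy (liftR (liftR (liftR ρ))) C | map-renTm (liftR ρ) d
            | map-renTm ρ a | map-renTm ρ b | map-renTm ρ p = refl
    map-renTm ρ ze = refl
    map-renTm ρ (su a) = cong su (map-renTm ρ a)
    map-renTm ρ (natrec C z c a)
      rewrite map-renTy (liftR ρ) C | map-renTm ρ z
            | map-renTm (liftR (liftR ρ)) c | map-renTm ρ a = refl
    map-renTm ρ (const α) = refl

  SubRel : ∀ {m n} → Sub m n → Sub m n → Set
  SubRel σ τ = ∀ x → mapTm (σ x) ≡ τ x

  liftRel : ∀ {m n} {σ : Sub m n} {τ} → SubRel σ τ → SubRel (liftS σ) (liftS τ)
  liftRel e zero = refl
  liftRel {σ = σ} e (suc x) = trans (map-renTm suc (σ x)) (cong wkTm (e x))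

  ∷Rel : ∀ {m n} {σ : Sub m n} {τ} → SubRel σ τ → ∀ a → SubRel (σ ∷ₛ a) (τ ∷ₛ mapTm a)
  ∷Rel e a zero = refl
  ∷Rel e a (suc x) = e x

  mutual
    map-subTy : ∀ {m n} {σ : Sub m n} {τ} → SubRel σ τ → (A : Ty G m) →
                mapTy (subTy σ A) ≡ subTy τ (mapTy A)
    map-subTy e `G = refl
    map-subTy e `ℕ = refl
    map-subTy e (`Π A B) = cong₂ `Π (map-subTy e A) (map-subTy (liftRel e) B)
    map-subTy e (`Σ A B) = cong₂ `Σ (map-subTy e A) (map-subTy (liftRel e) B)
    map-subTy e (`Id A a b)
      rewrite map-subTy e A | map-subTm e a | map-subTm e b = refl

    map-subTm : ∀ {m n} {σ : Sub m n} {τ} → SubRel σ τ → (a : Tm G m) →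
                mapTm (subTm σ a) ≡ subTm τ (mapTm a)
    map-subTm e (var x) = e x
    map-subTm e (lam b) = cong lam (map-subTm (liftRel e) b)
    map-subTm e (app f a) = cong₂ app (map-subTm e f) (map-subTm e a)
    map-subTm e (pair a b) = cong₂ pair (map-subTm e a) (map-subTm e b)
    map-subTm e (split C c p)
      rewrite map-subTy (liftRel e) C | map-subTm (liftRel (liftRel e)) c | map-subTm e p = refl
    map-subTm e (rfl a) = cong rfl (map-subTm e a)
    map-subTm e (J C d a b p)
      rewrite map-subTy (liftRel (liftRel (liftRel e))) C | map-subTm (liftRel e) d
            | map-subTm e a | map-subTm e b | map-subTm e p = refl
    map-subTm e ze = refl
    map-subTm e (su a) = cong su (map-subTm e a)
    map-subTm e (natrec C z c a)
      rewrite map-subTy (liftRel e) C | map-subTm e z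
            | map-subTm (liftRel (liftRel e)) c | map-subTm e a = refl
    map-subTm e (const α) = refl

  idRel : ∀ {n} → SubRel (idS {G} {n}) idS
  idRel x = refl

  wkRel : ∀ {n} → SubRel (wkS {G} {n}) wkS
  wkRel x = refl

  wk2Rel : ∀ {n} → SubRel (wk2S {G} {n}) wk2S
  wk2Rel x = refl

  map-lookup : ∀ {n} (Γ : Ctx G n) x → mapTy (lookup G Γ x) ≡ lookup H (mapCtx Γ) x
  map-lookup (Γ ▸ A) zero = map-renTy suc A
  map-lookup (Γ ▸ A) (suc x) = trans (map-renTy suc (lookup G Γ x)) (cong wkTy (map-lookup Γ x))

  map-cellTy : ∀ {n k} (α : RGSet.Cell G k) → mapTy (cellTy G {n} α) ≡ cellTy H (fun α)
  map-cellTy {k = zero} α = refl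
  map-cellTy {n} {suc k} α
    rewrite map-cellTy {n} {k} (RGSet.s G α) | fun-s α | fun-t α = refl

  private
    v1 : ∀ {K : RGSet} {n} → Tm K (suc (suc n))
    v1 = var (suc zero)
    v0 : ∀ {K : RGSet} {n} → Tm K (suc n)
    v0 = var zero

    JCtx : ∀ {K : RGSet} {n} → Ctx K n → Ty K n → Ctx K (suc (suc (suc n)))
    JCtx Γ A = Γ ▸ A ▸ wkTy A ▸ `Id (wkTy (wkTy A)) v1 v0

    map-JCtx : ∀ {n} (Γ : Ctx G n) A → mapCtx (JCtx Γ A) ≡ JCtx (mapCtx Γ) (mapTy A)
    map-JCtx Γ A =
      cong₂ (λ X Y → mapCtx Γ ▸ mapTy A ▸ X ▸ `Id Y v1 v0) (map-renTy suc A)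
            (trans (map-renTy suc (wkTy A)) (cong wkTy (map-renTy suc A)))

    castTm : ∀ {n} {Γ : Ctx H n} {a A B} → A ≡ B → Γ ⊢ a ∶ A → Γ ⊢ a ∶ B
    castTm refl d = d

    castEq : ∀ {n} {Γ : Ctx H n} {a b A B} → A ≡ B → Γ ⊢ a ≣ b ∶ A → Γ ⊢ a ≣ b ∶ B
    castEq refl d = d

    castEqR : ∀ {n} {Γ : Ctx H n} {a b b′ A} → b ≡ b′ → Γ ⊢ a ≣ b ∶ A → Γ ⊢ a ≣ b′ ∶ A
    castEqR refl d = d

    castCtxTy : ∀ {n} {Γ Δ : Ctx H n} {A} → Γ ≡ Δ → Γ ⊢Ty A → Δ ⊢Ty A
    castCtxTy refl d = d

    castCtxTyEq : ∀ {n} {Γ Δ : Ctx H n} {A B} → Γ ≡ Δ → Γ ⊢ A ≣Ty B → Δ ⊢ A ≣Ty B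
    castCtxTyEq refl d = d

    castCtxTm : ∀ {n} {Γ Δ : Ctx H n} {a A} → Γ ≡ Δ → Γ ⊢ a ∶ A → Δ ⊢ a ∶ A
    castCtxTm refl d = d

    castCtxEq : ∀ {n} {Γ Δ : Ctx H n} {a b A} → Γ ≡ Δ → Γ ⊢ a ≣ b ∶ A → Δ ⊢ a ≣ b ∶ A
    castCtxEq refl d = d

    e₀ : ∀ {n} (B : Ty G (suc n)) a → mapTy (B [ a ]₀) ≡ mapTy B [ mapTm a ]₀
    e₀ B a = map-subTy (∷Rel idRel a) B

    eSplit : ∀ {n} (C : Ty G (suc n)) →
             mapTy (subTy (wk2S ∷ₛ pair v1 v0) C) ≡ subTy (wk2S ∷ₛ pair v1 v0) (mapTy C)
    eSplit C = map-subTy (∷Rel wk2Rel (pair v1 v0)) C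

    eJd : ∀ {n} (C : Ty G (suc (suc (suc n)))) →
          mapTy (subTy (wkS ∷ₛ v0 ∷ₛ v0 ∷ₛ rfl v0) C) ≡ subTy (wkS ∷ₛ v0 ∷ₛ v0 ∷ₛ rfl v0) (mapTy C)
    eJd C = map-subTy (∷Rel (∷Rel (∷Rel wkRel v0) v0) (rfl v0)) C

    eJ : ∀ {n} (C : Ty G (suc (suc (suc n)))) a b p →
         mapTy (subTy (idS ∷ₛ a ∷ₛ b ∷ₛ p) C) ≡ subTy (idS ∷ₛ mapTm a ∷ₛ mapTm b ∷ₛ mapTm p) (mapTy C)
    eJ C a b p = map-subTy (∷Rel (∷Rel (∷Rel idRel a) b) p) C

    eRec : ∀ {n} (C : Ty G (suc n)) →
           mapTy (subTy (wk2S ∷ₛ su v1) C) ≡ subTy (wk2S ∷ₛ su v1) (mapTy C)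
    eRec C = map-subTy (∷Rel wk2Rel (su v1)) C

  mutual
    ⟦ctx⟧ : ∀ {n} {Γ : Ctx G n} → ⊢ Γ → ⊢ mapCtx Γ
    ⟦ctx⟧ ⊢ε = ⊢ε
    ⟦ctx⟧ (⊢▸ g A) = ⊢▸ (⟦ctx⟧ g) (⟦ty⟧ A)

    ⟦ty⟧ : ∀ {n} {Γ : Ctx G n} {A} → Γ ⊢Ty A → mapCtx Γ ⊢Ty mapTy A
    ⟦ty⟧ (G-F g) = G-F (⟦ctx⟧ g)
    ⟦ty⟧ (ℕ-F g) = ℕ-F (⟦ctx⟧ g)
    ⟦ty⟧ (Π-F A B) = Π-F (⟦ty⟧ A) (⟦ty⟧ B)
    ⟦ty⟧ (Σ-F A B) = Σ-F (⟦ty⟧ A) (⟦ty⟧ B)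
    ⟦ty⟧ (Id-F A a b) = Id-F (⟦ty⟧ A) (⟦tm⟧ a) (⟦tm⟧ b)

    ⟦tyeq⟧ : ∀ {n} {Γ : Ctx G n} {A B} → Γ ⊢ A ≣Ty B → mapCtx Γ ⊢ mapTy A ≣Ty mapTy B
    ⟦tyeq⟧ (ty-refl A) = ty-refl (⟦ty⟧ A)
    ⟦tyeq⟧ (ty-sym e) = ty-sym (⟦tyeq⟧ e)
    ⟦tyeq⟧ (ty-trans e e′) = ty-trans (⟦tyeq⟧ e) (⟦tyeq⟧ e′)
    ⟦tyeq⟧ (Π-cong A e e′) = Π-cong (⟦ty⟧ A) (⟦tyeq⟧ e) (⟦tyeq⟧ e′)
    ⟦tyeq⟧ (Σ-cong A e e′) = Σ-cong (⟦ty⟧ A) (⟦tyeq⟧ e) (⟦tyeq⟧ e′)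
    ⟦tyeq⟧ (Id-cong e a b) = Id-cong (⟦tyeq⟧ e) (⟦tmeq⟧ a) (⟦tmeq⟧ b)

    ⟦tm⟧ : ∀ {n} {Γ : Ctx G n} {a A} → Γ ⊢ a ∶ A → mapCtx Γ ⊢ mapTm a ∶ mapTy A
    ⟦tm⟧ {Γ = Γ} (var g x) = castTm (sym (map-lookup Γ x)) (var (⟦ctx⟧ g) x)
    ⟦tm⟧ (conv a e) = conv (⟦tm⟧ a) (⟦tyeq⟧ e)
    ⟦tm⟧ (lam A b) = lam (⟦ty⟧ A) (⟦tm⟧ b)
    ⟦tm⟧ (app {B = B} {a = a} f x) = castTm (sym (e₀ B a)) (app (⟦tm⟧ f) (⟦tm⟧ x))
    ⟦tm⟧ (pair {B = B} {a = a} A B′ x y) =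
      pair (⟦ty⟧ A) (⟦ty⟧ B′) (⟦tm⟧ x) (castTm (e₀ B a) (⟦tm⟧ y))
    ⟦tm⟧ (split {C = C} {p = p} Cd c q) =
      castTm (sym (e₀ C p)) (split (⟦ty⟧ Cd) (castTm (eSplit C) (⟦tm⟧ c)) (⟦tm⟧ q))
    ⟦tm⟧ (rfl a) = rfl (⟦tm⟧ a)
    ⟦tm⟧ {Γ = Γ} (J {A = A} {C = C} {a = a} {b = b} {p = p} Cd d x y q) =
      castTm (sym (eJ C a b p))
        (J (castCtxTy (map-JCtx Γ A) (⟦ty⟧ Cd)) (castTm (eJd C) (⟦tm⟧ d))
           (⟦tm⟧ x) (⟦tm⟧ y) (⟦tm⟧ q))
    ⟦tm⟧ (ze g) = ze (⟦ctx⟧ g)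
    ⟦tm⟧ (su a) = su (⟦tm⟧ a)
    ⟦tm⟧ (natrec {C = C} {a = a} Cd z c x) =
      castTm (sym (e₀ C a))
        (natrec (⟦ty⟧ Cd) (castTm (e₀ C ze) (⟦tm⟧ z)) (castTm (eRec C) (⟦tm⟧ c)) (⟦tm⟧ x))
    ⟦tm⟧ (const g α) = castTm (sym (map-cellTy α)) (const (⟦ctx⟧ g) (fun α))

    ⟦tmeq⟧ : ∀ {n} {Γ : Ctx G n} {a b A} → Γ ⊢ a ≣ b ∶ A →
             mapCtx Γ ⊢ mapTm a ≣ mapTm b ∶ mapTy A
    ⟦tmeq⟧ (tm-refl a) = tm-refl (⟦tm⟧ a)
    ⟦tmeq⟧ (tm-sym e) = tm-sym (⟦tmeq⟧ e)
    ⟦tmeq⟧ (tm-trans e e′) = tm-trans (⟦tmeq⟧ e) (⟦tmeq⟧ e′)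
    ⟦tmeq⟧ (conv e e′) = conv (⟦tmeq⟧ e) (⟦tyeq⟧ e′)
    ⟦tmeq⟧ (lam-cong A e) = lam-cong (⟦ty⟧ A) (⟦tmeq⟧ e)
    ⟦tmeq⟧ (app-cong {B = B} {a = a} f x) = castEq (sym (e₀ B a)) (app-cong (⟦tmeq⟧ f) (⟦tmeq⟧ x))
    ⟦tmeq⟧ (pair-cong {B = B} {a = a} A B′ x y) =
      pair-cong (⟦ty⟧ A) (⟦ty⟧ B′) (⟦tmeq⟧ x) (castEq (e₀ B a) (⟦tmeq⟧ y))
    ⟦tmeq⟧ (split-cong {C = C} {p = p} Cd c q) =
      castEq (sym (e₀ C p)) (split-cong (⟦tyeq⟧ Cd) (castEq (eSplit C) (⟦tmeq⟧ c)) (⟦tmeq⟧ q))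
    ⟦tmeq⟧ (rfl-cong e) = rfl-cong (⟦tmeq⟧ e)
    ⟦tmeq⟧ {Γ = Γ} (J-cong {A = A} {C = C} {a = a} {b = b} {p = p} Cd d x y q) =
      castEq (sym (eJ C a b p))
        (J-cong (castCtxTyEq (map-JCtx Γ A) (⟦tyeq⟧ Cd)) (castEq (eJd C) (⟦tmeq⟧ d))
           (⟦tmeq⟧ x) (⟦tmeq⟧ y) (⟦tmeq⟧ q))
    ⟦tmeq⟧ (su-cong e) = su-cong (⟦tmeq⟧ e)
    ⟦tmeq⟧ (natrec-cong {C = C} {a = a} Cd z c x) =
      castEq (sym (e₀ C a))
        (natrec-cong (⟦tyeq⟧ Cd) (castEq (e₀ C ze) (⟦tmeq⟧ z)) (castEq (eRec C) (⟦tmeq⟧ c))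
           (⟦tmeq⟧ x))
    ⟦tmeq⟧ (Π-β {B = B} {b = b} {a = a} A y x) =
      castEq (sym (e₀ B a)) (castEqR (sym (map-subTm (∷Rel idRel a) b))
        (Π-β (⟦ty⟧ A) (⟦tm⟧ y) (⟦tm⟧ x)))
    ⟦tmeq⟧ (Π-η {f = f} x) =
      castEqR (cong (λ u → lam (app u v0)) (sym (map-renTm suc f))) (Π-η (⟦tm⟧ x))
    ⟦tmeq⟧ (Σ-β {B = B} {C = C} {c = c} {a = a} {b = b} B′ Cd y x z) =
      castEq (sym (e₀ C (pair a b))) (castEqR (sym (map-subTm (∷Rel (∷Rel idRel a) b) c))
        (Σ-β (⟦ty⟧ B′) (⟦ty⟧ Cd) (castTm (eSplit C) (⟦tm⟧ y)) (⟦tm⟧ x)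
           (castTm (e₀ B a) (⟦tm⟧ z))))
    ⟦tmeq⟧ {Γ = Γ} (J-β {A = A} {C = C} {d = d} {a = a} Cd y x) =
      castEq (sym (eJ C a a (rfl a))) (castEqR (sym (map-subTm (∷Rel idRel a) d))
        (J-β (castCtxTy (map-JCtx Γ A) (⟦ty⟧ Cd)) (castTm (eJd C) (⟦tm⟧ y)) (⟦tm⟧ x)))
    ⟦tmeq⟧ (ℕ-β-ze {C = C} Cd z c) =
      castEq (sym (e₀ C ze))
        (ℕ-β-ze (⟦ty⟧ Cd) (castTm (e₀ C ze) (⟦tm⟧ z)) (castTm (eRec C) (⟦tm⟧ c)))
    ⟦tmeq⟧ (ℕ-β-su {C = C} {z = z} {c = c} {a = a} Cd zd cd x) =
      castEq (sym (e₀ C (su a)))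
        (castEqR (sym (map-subTm (∷Rel (∷Rel idRel a) (natrec C z c a)) c))
          (ℕ-β-su (⟦ty⟧ Cd) (castTm (e₀ C ze) (⟦tm⟧ zd)) (castTm (eRec C) (⟦tm⟧ cd)) (⟦tm⟧ x)))
    ⟦tmeq⟧ (Id-reflect p) = Id-reflect (⟦tm⟧ p)
    ⟦tmeq⟧ {Γ = Γ} (const-i g α) =
      castEq (sym (map-cellTy (RGSet.i G α)))
        (subst (λ u → mapCtx Γ ⊢ const u ≣ rfl (const (fun α)) ∶ cellTy H u) (sym (fun-i α))
          (const-i (⟦ctx⟧ g) (fun α)))

-- An n-cell is (α⃗ ; γ) where the "frame" α⃗ = (β⁰₀,β⁰₁ ; … ; βⁿ⁻¹₀,βⁿ⁻¹₁)
-- determines a closed iterated identity type tyR α⃗ on ⌜G⌝, and γ is a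
-- closed term of that type.

open import Data.Unit using (⊤; tt)

RFrame : RGSet → ℕ → Set
RFrame G zero = ⊤
RFrame G (suc n) = RFrame G n × Tm G zero × Tm G zero

tyR : ∀ {G n} → RFrame G n → Ty G zero
tyR {n = zero} _ = `G
tyR {n = suc n} (f , b₀ , b₁) = `Id (tyR f) b₀ b₁

WT : ∀ {G n} → RFrame G n → Set
WT {n = zero} _ = ⊤
WT {n = suc n} (f , b₀ , b₁) = WT f × (ε ⊢ b₀ ∶ tyR f) × (ε ⊢ b₁ ∶ tyR f)

_≈F_ : ∀ {G n} → RFrame G n → RFrame G n → Set
_≈F_ {n = zero} _ _ = ⊤
_≈F_ {n = suc n} (f , b₀ , b₁) (f′ , b₀′ , b₁′) =
  (f ≈F f′) × (ε ⊢ b₀ ≣ b₀′ ∶ tyR f) × (ε ⊢ b₁ ≣ b₁′ ∶ tyR f)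

record T₁Cell (G : RGSet) (n : ℕ) : Set where
  constructor cell
  field
    frame : RFrame G n
    wt : WT frame
    term : Tm G zero
    typed : ε ⊢ term ∶ tyR frame

_≈T_ : ∀ {G n} → T₁Cell G n → T₁Cell G n → Set
c ≈T c′ = (T₁Cell.frame c ≈F T₁Cell.frame c′) ×
          (ε ⊢ T₁Cell.term c ≣ T₁Cell.term c′ ∶ tyR (T₁Cell.frame c))

module _ {G : RGSet} where
  ≈F⇒ty : ∀ {n} {f f′ : RFrame G n} → f ≈F f′ → ε ⊢ tyR f ≣Ty tyR f′
  ≈F⇒ty {zero} _ = ty-refl (G-F ⊢ε)
  ≈F⇒ty {suc n} (e , e₀ , e₁) = Id-cong (≈F⇒ty e) e₀ e₁

  ≈F-refl : ∀ {n} {f : RFrame G n} → WT f → f ≈F f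
  ≈F-refl {zero} _ = tt
  ≈F-refl {suc n} (w , d₀ , d₁) = ≈F-refl w , tm-refl d₀ , tm-refl d₁

  ≈F-sym : ∀ {n} {f f′ : RFrame G n} → f ≈F f′ → f′ ≈F f
  ≈F-sym {zero} _ = tt
  ≈F-sym {suc n} (e , e₀ , e₁) =
    ≈F-sym e , conv (tm-sym e₀) (≈F⇒ty e) , conv (tm-sym e₁) (≈F⇒ty e)

  ≈F-trans : ∀ {n} {f f′ f″ : RFrame G n} → f ≈F f′ → f′ ≈F f″ → f ≈F f″
  ≈F-trans {zero} _ _ = tt
  ≈F-trans {suc n} (e , e₀ , e₁) (e′ , e₀′ , e₁′) =
    ≈F-trans e e′ ,
    tm-trans e₀ (conv e₀′ (ty-sym (≈F⇒ty e))) ,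
    tm-trans e₁ (conv e₁′ (ty-sym (≈F⇒ty e)))

  ≈T-refl : ∀ {n} (c : T₁Cell G n) → c ≈T c
  ≈T-refl (cell f w a d) = ≈F-refl w , tm-refl d

  ≈T-isEquivalence : ∀ {n} → IsEquivalence (_≈T_ {G} {n})
  ≈T-isEquivalence = record
    { refl = λ {c} → ≈T-refl c
    ; sym = λ { (e , e′) → ≈F-sym e , conv (tm-sym e′) (≈F⇒ty e) }
    ; trans = λ { (e , e′) (f , f′) → ≈F-trans e f , tm-trans e′ (conv f′ (ty-sym (≈F⇒ty e))) } }

  T₁s : ∀ {n} → T₁Cell G (suc n) → T₁Cell G n
  T₁s (cell (f , b₀ , b₁) (w , d₀ , d₁) _ _) = cell f w b₀ d₀

  T₁t : ∀ {n} → T₁Cell G (suc n) → T₁Cell G n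
  T₁t (cell (f , b₀ , b₁) (w , d₀ , d₁) _ _) = cell f w b₁ d₁

  T₁i : ∀ {n} → T₁Cell G n → T₁Cell G (suc n)
  T₁i (cell f w a d) = cell (f , a , a) (w , d , d) (rfl a) (rfl d)

T₁ : RGSet → SRGSet
T₁ G = record
  { Cell = T₁Cell G
  ; _≈_ = _≈T_
  ; isEquivalence = ≈T-isEquivalence
  ; s = T₁s ; t = T₁t ; i = T₁i
  ; s-cong = λ { ((e , e₀ , e₁) , _) → e , e₀ }
  ; t-cong = λ { ((e , e₀ , e₁) , _) → e , e₁ }
  ; i-cong = λ { (e , e′) → (e , e′ , e′) , rfl-cong e′ }
  ; ss≈st = λ x → ≈T-refl (T₁s (T₁s x))
  ; ts≈tt = λ x → ≈T-refl (T₁t (T₁s x))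
  ; si≈id = λ x → ≈T-refl x
  ; ti≈id = λ x → ≈T-refl x }

module _ {G H : RGSet} (φ : RGHom G H) where
  mapFrame : ∀ {n} → RFrame G n → RFrame H n
  mapFrame {zero} _ = tt
  mapFrame {suc n} (f , b₀ , b₁) = mapFrame f , mapTm φ b₀ , mapTm φ b₁

  map-tyR : ∀ {n} (f : RFrame G n) → mapTy φ (tyR f) ≡ tyR (mapFrame f)
  map-tyR {zero} _ = refl
  map-tyR {suc n} (f , b₀ , b₁) = cong (λ X → `Id X (mapTm φ b₀) (mapTm φ b₁)) (map-tyR f)

  private
    castT : ∀ {a A B} → A ≡ B → ε {H} ⊢ a ∶ A → ε ⊢ a ∶ B
    castT refl d = d
    castE : ∀ {a b A B} → A ≡ B → ε {H} ⊢ a ≣ b ∶ A → ε ⊢ a ≣ b ∶ B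
    castE refl d = d

  mapWT : ∀ {n} (f : RFrame G n) → WT f → WT (mapFrame f)
  mapWT {zero} _ _ = tt
  mapWT {suc n} (f , _ , _) (w , d₀ , d₁) =
    mapWT f w , castT (map-tyR f) (⟦tm⟧ φ d₀) , castT (map-tyR f) (⟦tm⟧ φ d₁)

  map≈F : ∀ {n} (f f′ : RFrame G n) → f ≈F f′ → mapFrame f ≈F mapFrame f′
  map≈F {zero} _ _ _ = tt
  map≈F {suc n} (f , _ , _) (f′ , _ , _) (e , e₀ , e₁) =
    map≈F f f′ e , castE (map-tyR f) (⟦tmeq⟧ φ e₀) , castE (map-tyR f) (⟦tmeq⟧ φ e₁)

  T₁map : ∀ {n} → T₁Cell G n → T₁Cell H n
  T₁map (cell f w a d) = cell (mapFrame f) (mapWT f w) (mapTm φ a) (castT (map-tyR f) (⟦tm⟧ φ d))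

T₁hom : ∀ {G H} → RGHom G H → SRGHom (T₁ G) (T₁ H)
T₁hom φ = record
  { fun = T₁map φ
  ; fun-cong = λ { {x = cell f _ _ _} {y = cell f′ _ _ _} (e , e′) →
                   map≈F φ f f′ e , castE′ (map-tyR φ f) (⟦tmeq⟧ φ e′) }
  ; fun-s = λ x → ≈T-refl (T₁map φ (T₁s x))
  ; fun-t = λ x → ≈T-refl (T₁map φ (T₁t x))
  ; fun-i = λ x → ≈T-refl (T₁map φ (T₁i x)) }
  where
    castE′ : ∀ {H : RGSet} {a b} {A B : Ty H zero} → A ≡ B → ε ⊢ a ≣ b ∶ A → ε ⊢ a ≣ b ∶ B
    castE′ refl d = d

module Submission where

-- 𝕋₁[G] is finitary: a type, term or derivation mentions finitely many basic terms. Hence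
-- every piece of raw syntax over A∞ comes from syntax at one stage of the filtered diagram,
-- and syntax identified in A∞ is already identified at a later stage. By induction on
-- derivations, a judgement of 𝕋₁[A∞] whose syntax comes from stage c becomes derivable after
-- pushing along some c → d; a premise whose syntax is not fixed by the conclusion (the middle
-- type of a transitivity, the source type of a conversion, …) is lifted separately and the
-- two stages are joined. So every cell of T₁(A∞) comes from some T₁(A a), and cells
-- identified in T₁(A∞) are identified at some stage: these are the two halves of the
-- universal property of the filtered colimit.

open import Defs
open import Data.Nat using (ℕ; zero; suc)
open import Data.Fin using (zero; suc)
open import Data.Product using (Σ; _×_; _,_; proj₁; proj₂)
open import Data.Unit using (⊤; tt)
open import Relation.Binary.Bundles using (Setoid)
open import Relation.Binary.PropositionalEquality hiding (J)
import Relation.Binary.Reasoning.Setoid as SetoidReasoning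

module _ {G H K : RGSet} (φ : RGHom G H) (ψ : RGHom H K) (χ : RGHom G K)
  (χ≗ψ∘φ : ∀ {k} (x : RGSet.Cell G k) → RGHom.fun χ x ≡ RGHom.fun ψ (RGHom.fun φ x)) where
  mutual
    mapTy-∘ : ∀ {n} (X : Ty G n) → mapTy χ X ≡ mapTy ψ (mapTy φ X)
    mapTy-∘ `G = refl
    mapTy-∘ `ℕ = refl
    mapTy-∘ (`Π A B) = cong₂ `Π (mapTy-∘ A) (mapTy-∘ B)
    mapTy-∘ (`Σ A B) = cong₂ `Σ (mapTy-∘ A) (mapTy-∘ B)
    mapTy-∘ (`Id A a b) rewrite mapTy-∘ A | mapTm-∘ a | mapTm-∘ b = refl

    mapTm-∘ : ∀ {n} (X : Tm G n) → mapTm χ X ≡ mapTm ψ (mapTm φ X)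
    mapTm-∘ (var x) = refl
    mapTm-∘ (lam b) = cong lam (mapTm-∘ b)
    mapTm-∘ (app f a) = cong₂ app (mapTm-∘ f) (mapTm-∘ a)
    mapTm-∘ (pair a b) = cong₂ pair (mapTm-∘ a) (mapTm-∘ b)
    mapTm-∘ (split C c p) rewrite mapTy-∘ C | mapTm-∘ c | mapTm-∘ p = refl
    mapTm-∘ (rfl a) = cong rfl (mapTm-∘ a)
    mapTm-∘ (J C d a b p) rewrite mapTy-∘ C | mapTm-∘ d | mapTm-∘ a | mapTm-∘ b | mapTm-∘ p = refl
    mapTm-∘ ze = refl
    mapTm-∘ (su a) = cong su (mapTm-∘ a)
    mapTm-∘ (natrec C z c a) rewrite mapTy-∘ C | mapTm-∘ z | mapTm-∘ c | mapTm-∘ a = refl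
    mapTm-∘ (const α) = cong const (χ≗ψ∘φ α)

  mapCtx-∘ : ∀ {n} (Γ : Ctx G n) → mapCtx χ Γ ≡ mapCtx ψ (mapCtx φ Γ)
  mapCtx-∘ ε = refl
  mapCtx-∘ (Γ ▸ A) = cong₂ _▸_ (mapCtx-∘ Γ) (mapTy-∘ A)

  mapFrame-∘ : ∀ {n} (f : RFrame G n) → mapFrame χ f ≡ mapFrame ψ (mapFrame φ f)
  mapFrame-∘ {zero} _ = refl
  mapFrame-∘ {suc n} (f , a , b) rewrite mapFrame-∘ f | mapTm-∘ a | mapTm-∘ b = refl

module _ {G : RGSet} where
  subst-⊢ : ∀ {n} {Γ Γ′ : Ctx G n} → Γ ≡ Γ′ → ⊢ Γ → ⊢ Γ′
  subst-⊢ refl d = d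

  subst-⊢Ty : ∀ {n} {Γ Γ′ : Ctx G n} {A A′} → Γ ≡ Γ′ → A ≡ A′ → Γ ⊢Ty A → Γ′ ⊢Ty A′
  subst-⊢Ty refl refl d = d

  subst-⊢≣Ty : ∀ {n} {Γ Γ′ : Ctx G n} {A A′ B B′} → Γ ≡ Γ′ → A ≡ A′ → B ≡ B′ →
               Γ ⊢ A ≣Ty B → Γ′ ⊢ A′ ≣Ty B′
  subst-⊢≣Ty refl refl refl d = d

  subst-⊢∶ : ∀ {n} {Γ Γ′ : Ctx G n} {a a′ A A′} → Γ ≡ Γ′ → a ≡ a′ → A ≡ A′ →
             Γ ⊢ a ∶ A → Γ′ ⊢ a′ ∶ A′
  subst-⊢∶ refl refl refl d = d

  subst-⊢≣∶ : ∀ {n} {Γ Γ′ : Ctx G n} {a a′ b b′ A A′} → Γ ≡ Γ′ → a ≡ a′ → b ≡ b′ → A ≡ A′ →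
              Γ ⊢ a ≣ b ∶ A → Γ′ ⊢ a′ ≣ b′ ∶ A′
  subst-⊢≣∶ refl refl refl refl d = d

  retype-∶ : ∀ {n} {Γ : Ctx G n} {a A A′} → A ≡ A′ → Γ ⊢ a ∶ A → Γ ⊢ a ∶ A′
  retype-∶ = subst-⊢∶ refl refl

  retype-≣ : ∀ {n} {Γ : Ctx G n} {a b A A′} → A ≡ A′ → Γ ⊢ a ≣ b ∶ A → Γ ⊢ a ≣ b ∶ A′
  retype-≣ = subst-⊢≣∶ refl refl refl

  Π-injective : ∀ {n} {A A′ : Ty G n} {B B′} → `Π A B ≡ `Π A′ B′ → A ≡ A′ × B ≡ B′
  Π-injective refl = refl , refl

  Σ-injective : ∀ {n} {A A′ : Ty G n} {B B′} → `Σ A B ≡ `Σ A′ B′ → A ≡ A′ × B ≡ B′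
  Σ-injective refl = refl , refl

  Id-injective : ∀ {n} {A A′ : Ty G n} {a a′ b b′} → `Id A a b ≡ `Id A′ a′ b′ →
                 A ≡ A′ × a ≡ a′ × b ≡ b′
  Id-injective refl = refl , refl , refl

  lam-injective : ∀ {n} {b b′ : Tm G (suc n)} → _≡_ {A = Tm G n} (lam b) (lam b′) → b ≡ b′
  lam-injective refl = refl

  app-injective : ∀ {n} {f f′ a a′ : Tm G n} → app f a ≡ app f′ a′ → f ≡ f′ × a ≡ a′
  app-injective refl = refl , refl

  pair-injective : ∀ {n} {a a′ b b′ : Tm G n} → pair a b ≡ pair a′ b′ → a ≡ a′ × b ≡ b′
  pair-injective refl = refl , refl

  split-injective : ∀ {n} {C C′ c c′ p p′} → _≡_ {A = Tm G n} (split C c p) (split C′ c′ p′) →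
                    C ≡ C′ × c ≡ c′ × p ≡ p′
  split-injective refl = refl , refl , refl

  rfl-injective : ∀ {n} {a a′ : Tm G n} → rfl a ≡ rfl a′ → a ≡ a′
  rfl-injective refl = refl

  J-injective : ∀ {n} {C C′ d d′ a a′ b b′ p p′} →
                _≡_ {A = Tm G n} (J C d a b p) (J C′ d′ a′ b′ p′) →
                C ≡ C′ × d ≡ d′ × a ≡ a′ × b ≡ b′ × p ≡ p′
  J-injective refl = refl , refl , refl , refl , refl

  su-injective : ∀ {n} {a a′ : Tm G n} → su a ≡ su a′ → a ≡ a′
  su-injective refl = refl

  natrec-injective : ∀ {n} {C C′ z z′ c c′ a a′} →
                     _≡_ {A = Tm G n} (natrec C z c a) (natrec C′ z′ c′ a′) →
                     C ≡ C′ × z ≡ z′ × c ≡ c′ × a ≡ a′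
  natrec-injective refl = refl , refl , refl , refl

  const-injective : ∀ {n k k′} {x : RGSet.Cell G k} {y : RGSet.Cell G k′} →
                    _≡_ {A = Tm G n} (const x) (const y) → Σ (k ≡ k′) λ { refl → x ≡ y }
  const-injective refl = refl , refl

v1 : ∀ {G : RGSet} {n} → Tm G (suc (suc n))
v1 = var (suc zero)

v0 : ∀ {G : RGSet} {n} → Tm G (suc n)
v0 = var zero

JCtx : ∀ {G : RGSet} {n} → Ctx G n → Ty G n → Ctx G (suc (suc (suc n)))
JCtx Γ A = Γ ▸ A ▸ wkTy A ▸ `Id (wkTy (wkTy A)) v1 v0

module _ {G : RGSet} where
  cong-Id : ∀ {n} {A A′ : Ty G n} {a a′ b b′} → A ≡ A′ → a ≡ a′ → b ≡ b′ → `Id A a b ≡ `Id A′ a′ b′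
  cong-Id refl refl refl = refl

  cong-sub₁Tm : ∀ {n} {b b′ : Tm G (suc n)} {a a′} → b ≡ b′ → a ≡ a′ →
                subTm (idS ∷ₛ a) b ≡ subTm (idS ∷ₛ a′) b′
  cong-sub₁Tm refl refl = refl

  cong-sub₂Tm : ∀ {n} {c c′ : Tm G (suc (suc n))} {a a′ b b′} → c ≡ c′ → a ≡ a′ → b ≡ b′ →
                subTm (idS ∷ₛ a ∷ₛ b) c ≡ subTm (idS ∷ₛ a′ ∷ₛ b′) c′
  cong-sub₂Tm refl refl refl = refl

  cong-sub₃Ty : ∀ {n} {C C′ : Ty G (suc (suc (suc n)))} {a a′ b b′ p p′ : Tm G n} →
                C ≡ C′ → a ≡ a′ → b ≡ b′ → p ≡ p′ →
                subTy (idS ∷ₛ a ∷ₛ b ∷ₛ p) C ≡ subTy (idS ∷ₛ a′ ∷ₛ b′ ∷ₛ p′) C′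
  cong-sub₃Ty refl refl refl refl = refl

  cong-split : ∀ {n} {C C′ c c′} {p p′ : Tm G n} → C ≡ C′ → c ≡ c′ → p ≡ p′ →
               split C c p ≡ split C′ c′ p′
  cong-split refl refl refl = refl

  cong-J : ∀ {n} {C C′ d d′} {a a′ b b′ p p′ : Tm G n} →
           C ≡ C′ → d ≡ d′ → a ≡ a′ → b ≡ b′ → p ≡ p′ → J C d a b p ≡ J C′ d′ a′ b′ p′
  cong-J refl refl refl refl refl = refl

  cong-natrec : ∀ {n} {C C′ z z′ c c′} {a a′ : Tm G n} → C ≡ C′ → z ≡ z′ → c ≡ c′ → a ≡ a′ →
                natrec C z c a ≡ natrec C′ z′ c′ a′
  cong-natrec refl refl refl refl = refl

  cong-JCtx : ∀ {n} {Γ Γ′ : Ctx G n} {A A′} → Γ ≡ Γ′ → A ≡ A′ → JCtx Γ A ≡ JCtx Γ′ A′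
  cong-JCtx refl refl = refl

module _ {G H : RGSet} (φ : RGHom G H) where
  map-[]₀ : ∀ {n} (B : Ty G (suc n)) a → mapTy φ (B [ a ]₀) ≡ mapTy φ B [ mapTm φ a ]₀
  map-[]₀ B a = map-subTy φ (∷Rel φ (idRel φ) a) B

  map-sub₁Tm : ∀ {n} (b : Tm G (suc n)) a →
               mapTm φ (subTm (idS ∷ₛ a) b) ≡ subTm (idS ∷ₛ mapTm φ a) (mapTm φ b)
  map-sub₁Tm b a = map-subTm φ (∷Rel φ (idRel φ) a) b

  map-sub₂Tm : ∀ {n} (c : Tm G (suc (suc n))) a b →
               mapTm φ (subTm (idS ∷ₛ a ∷ₛ b) c) ≡ subTm (idS ∷ₛ mapTm φ a ∷ₛ mapTm φ b) (mapTm φ c)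
  map-sub₂Tm c a b = map-subTm φ (∷Rel φ (∷Rel φ (idRel φ) a) b) c

  map-sub₃Ty : ∀ {n} (C : Ty G (suc (suc (suc n)))) a b p →
               mapTy φ (subTy (idS ∷ₛ a ∷ₛ b ∷ₛ p) C)
                 ≡ subTy (idS ∷ₛ mapTm φ a ∷ₛ mapTm φ b ∷ₛ mapTm φ p) (mapTy φ C)
  map-sub₃Ty C a b p = map-subTy φ (∷Rel φ (∷Rel φ (∷Rel φ (idRel φ) a) b) p) C

  map-splitTy : ∀ {n} (C : Ty G (suc n)) →
                mapTy φ (subTy (wk2S ∷ₛ pair v1 v0) C) ≡ subTy (wk2S ∷ₛ pair v1 v0) (mapTy φ C)
  map-splitTy C = map-subTy φ (∷Rel φ (wk2Rel φ) (pair v1 v0)) C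

  map-natrecTy : ∀ {n} (C : Ty G (suc n)) →
                 mapTy φ (subTy (wk2S ∷ₛ su v1) C) ≡ subTy (wk2S ∷ₛ su v1) (mapTy φ C)
  map-natrecTy C = map-subTy φ (∷Rel φ (wk2Rel φ) (su v1)) C

  map-JbaseTy : ∀ {n} (C : Ty G (suc (suc (suc n)))) →
                mapTy φ (subTy (wkS ∷ₛ v0 ∷ₛ v0 ∷ₛ rfl v0) C)
                  ≡ subTy (wkS ∷ₛ v0 ∷ₛ v0 ∷ₛ rfl v0) (mapTy φ C)
  map-JbaseTy C = map-subTy φ (∷Rel φ (∷Rel φ (∷Rel φ (wkRel φ) v0) v0) (rfl v0)) C

  map-wkTm : ∀ {n} (f : Tm G n) → mapTm φ (wkTm f) ≡ wkTm (mapTm φ f)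
  map-wkTm = map-renTm φ suc

  map-JCtx : ∀ {n} (Γ : Ctx G n) A → mapCtx φ (JCtx Γ A) ≡ JCtx (mapCtx φ Γ) (mapTy φ A)
  map-JCtx Γ A = cong₂ (λ X Y → mapCtx φ Γ ▸ mapTy φ A ▸ X ▸ `Id Y v1 v0) (map-renTy φ suc A)
                   (trans (map-renTy φ suc (wkTy A)) (cong wkTy (map-renTy φ suc A)))

cellSetoid : SRGSet → ℕ → Setoid _ _
cellSetoid X n = record { Carrier = SRGSet.Cell X n ; _≈_ = SRGSet._≈_ X ; isEquivalence = SRGSet.isEquivalence X }

module _ {𝒞 : Category} {D : Category.Obj 𝒞 → SRGSet}
         {Dhom : ∀ {a b} → Category.Hom 𝒞 a b → SRGHom (D a) (D b)}
         {X : SRGSet} {ℓ : ∀ a → SRGHom (D a) X} (isColimit : IsColimit 𝒞 D Dhom X ℓ) where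
  open SRGHom using (fun)
  private
    module X = SRGSet X

    FixesCocone : SRGHom X X → Set
    FixesCocone m = ∀ a {n} (x : SRGSet.Cell (D a) n) → fun m (fun (ℓ a) x) X.≈ fun (ℓ a) x

    mediator : SRGHom X X
    mediator = proj₁ (IsColimit.universal isColimit X ℓ (IsColimit.commutes isColimit))

    ≈-mediator : (m : SRGHom X X) → FixesCocone m → ∀ {n} (x : X.Cell n) → fun m x X.≈ fun mediator x
    ≈-mediator = proj₂ (proj₂ (IsColimit.universal isColimit X ℓ (IsColimit.commutes isColimit)))

  colimit-endo-unique : (m m′ : SRGHom X X) → FixesCocone m → FixesCocone m′ →
                        ∀ {n} (x : X.Cell n) → fun m x X.≈ fun m′ x
  colimit-endo-unique m m′ m-fixes m′-fixes {n} x =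
    Setoid.trans (cellSetoid X n) (≈-mediator m m-fixes x) (Setoid.sym (cellSetoid X n) (≈-mediator m′ m′-fixes x))

module _ {G : RGSet} {n : ℕ} where
  ≡⇒≈T : (x y : T₁Cell G n) → T₁Cell.frame x ≡ T₁Cell.frame y → T₁Cell.term x ≡ T₁Cell.term y → x ≈T y
  ≡⇒≈T x@(cell _ _ _ _) (cell _ _ _ _) refl refl = ≈T-refl x

module FilteredDiagram (𝓘 : Category) (F : IsFiltered 𝓘) (A : Functor 𝓘) where
  open Category 𝓘
  open IsFiltered F

  A[_] : Obj → RGSet
  A[_] = Functor.obj A

  A⟪_⟫ : ∀ {a b} → Hom a b → RGHom A[ a ] A[ b ]
  A⟪_⟫ = Functor.hom A

  Cell : Obj → ℕ → Set
  Cell a = RGSet.Cell A[ a ]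

  pushCell : ∀ {a b} → Hom a b → ∀ {k} → Cell a k → Cell b k
  pushCell f = RGHom.fun A⟪ f ⟫

  pushTy : ∀ {a b} → Hom a b → ∀ {n} → Ty A[ a ] n → Ty A[ b ] n
  pushTy f = mapTy A⟪ f ⟫

  pushTm : ∀ {a b} → Hom a b → ∀ {n} → Tm A[ a ] n → Tm A[ b ] n
  pushTm f = mapTm A⟪ f ⟫

  pushCtx : ∀ {a b} → Hom a b → ∀ {n} → Ctx A[ a ] n → Ctx A[ b ] n
  pushCtx f = mapCtx A⟪ f ⟫

  pushCell-∘ : ∀ {a b c} (g : Hom b c) (f : Hom a b) {k} (x : Cell a k) →
               pushCell (g ∘c f) x ≡ pushCell g (pushCell f x)
  pushCell-∘ = Functor.hom-∘ A

  module _ {a b c} (g : Hom b c) (f : Hom a b) where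
    pushTy-∘ : ∀ {n} (X : Ty A[ a ] n) → pushTy (g ∘c f) X ≡ pushTy g (pushTy f X)
    pushTy-∘ = mapTy-∘ A⟪ f ⟫ A⟪ g ⟫ A⟪ g ∘c f ⟫ (pushCell-∘ g f)

    pushTm-∘ : ∀ {n} (X : Tm A[ a ] n) → pushTm (g ∘c f) X ≡ pushTm g (pushTm f X)
    pushTm-∘ = mapTm-∘ A⟪ f ⟫ A⟪ g ⟫ A⟪ g ∘c f ⟫ (pushCell-∘ g f)

    pushCtx-∘ : ∀ {n} (Γ : Ctx A[ a ] n) → pushCtx (g ∘c f) Γ ≡ pushCtx g (pushCtx f Γ)
    pushCtx-∘ = mapCtx-∘ A⟪ f ⟫ A⟪ g ⟫ A⟪ g ∘c f ⟫ (pushCell-∘ g f)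

  infixr 4 _&_ _&&_
  data Judgement (c : Obj) : Set where
    jTrue : Judgement c
    jCtx : ∀ {n} → Ctx A[ c ] n → Judgement c
    jTy : ∀ {n} → Ctx A[ c ] n → Ty A[ c ] n → Judgement c
    jTyEq : ∀ {n} → Ctx A[ c ] n → Ty A[ c ] n → Ty A[ c ] n → Judgement c
    jTm : ∀ {n} → Ctx A[ c ] n → Tm A[ c ] n → Ty A[ c ] n → Judgement c
    jTmEq : ∀ {n} → Ctx A[ c ] n → Tm A[ c ] n → Tm A[ c ] n → Ty A[ c ] n → Judgement c
    eTy : ∀ {n} → Ty A[ c ] n → Ty A[ c ] n → Judgement c
    eTm : ∀ {n} → Tm A[ c ] n → Tm A[ c ] n → Judgement c
    eCell : ∀ {k} → Cell c k → Cell c k → Judgement c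
    _&_ : Judgement c → Judgement c → Judgement c

  ⟦_⟧ : ∀ {c} → Judgement c → ∀ {d} → Hom c d → Set
  ⟦ jTrue ⟧ h = ⊤
  ⟦ jCtx Γ ⟧ h = ⊢ pushCtx h Γ
  ⟦ jTy Γ A ⟧ h = pushCtx h Γ ⊢Ty pushTy h A
  ⟦ jTyEq Γ A B ⟧ h = pushCtx h Γ ⊢ pushTy h A ≣Ty pushTy h B
  ⟦ jTm Γ a A ⟧ h = pushCtx h Γ ⊢ pushTm h a ∶ pushTy h A
  ⟦ jTmEq Γ a b A ⟧ h = pushCtx h Γ ⊢ pushTm h a ≣ pushTm h b ∶ pushTy h A
  ⟦ eTy X Y ⟧ h = pushTy h X ≡ pushTy h Y
  ⟦ eTm X Y ⟧ h = pushTm h X ≡ pushTm h Y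
  ⟦ eCell x y ⟧ h = pushCell h x ≡ pushCell h y
  ⟦ j & j′ ⟧ h = ⟦ j ⟧ h × ⟦ j′ ⟧ h

  pushJ : ∀ {c d} → Hom c d → Judgement c → Judgement d
  pushJ h jTrue = jTrue
  pushJ h (jCtx Γ) = jCtx (pushCtx h Γ)
  pushJ h (jTy Γ A) = jTy (pushCtx h Γ) (pushTy h A)
  pushJ h (jTyEq Γ A B) = jTyEq (pushCtx h Γ) (pushTy h A) (pushTy h B)
  pushJ h (jTm Γ a A) = jTm (pushCtx h Γ) (pushTm h a) (pushTy h A)
  pushJ h (jTmEq Γ a b A) = jTmEq (pushCtx h Γ) (pushTm h a) (pushTm h b) (pushTy h A)
  pushJ h (eTy X Y) = eTy (pushTy h X) (pushTy h Y)
  pushJ h (eTm X Y) = eTm (pushTm h X) (pushTm h Y)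
  pushJ h (eCell x y) = eCell (pushCell h x) (pushCell h y)
  pushJ h (j & j′) = pushJ h j & pushJ h j′

  ⟦⟧-push : ∀ {c d e} (j : Judgement c) (h : Hom c d) (k : Hom d e) → ⟦ j ⟧ h → ⟦ pushJ h j ⟧ k
  ⟦⟧-push jTrue h k _ = tt
  ⟦⟧-push (jCtx Γ) h k D = ⟦ctx⟧ A⟪ k ⟫ D
  ⟦⟧-push (jTy Γ A) h k D = ⟦ty⟧ A⟪ k ⟫ D
  ⟦⟧-push (jTyEq Γ A B) h k D = ⟦tyeq⟧ A⟪ k ⟫ D
  ⟦⟧-push (jTm Γ a A) h k D = ⟦tm⟧ A⟪ k ⟫ D
  ⟦⟧-push (jTmEq Γ a b A) h k D = ⟦tmeq⟧ A⟪ k ⟫ D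
  ⟦⟧-push (eTy X Y) h k e = cong (pushTy k) e
  ⟦⟧-push (eTm X Y) h k e = cong (pushTm k) e
  ⟦⟧-push (eCell x y) h k e = cong (pushCell k) e
  ⟦⟧-push (j & j′) h k (p , q) = ⟦⟧-push j h k p , ⟦⟧-push j′ h k q

  ⟦pushJ⟧⇒ : ∀ {c d e} (j : Judgement c) (h : Hom c d) (k : Hom d e) →
             ⟦ pushJ h j ⟧ k → ⟦ j ⟧ (k ∘c h)
  ⟦pushJ⟧⇒ jTrue h k _ = tt
  ⟦pushJ⟧⇒ (jCtx Γ) h k D = subst-⊢ (sym (pushCtx-∘ k h Γ)) D
  ⟦pushJ⟧⇒ (jTy Γ A) h k D = subst-⊢Ty (sym (pushCtx-∘ k h Γ)) (sym (pushTy-∘ k h A)) D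
  ⟦pushJ⟧⇒ (jTyEq Γ A B) h k D =
    subst-⊢≣Ty (sym (pushCtx-∘ k h Γ)) (sym (pushTy-∘ k h A)) (sym (pushTy-∘ k h B)) D
  ⟦pushJ⟧⇒ (jTm Γ a A) h k D =
    subst-⊢∶ (sym (pushCtx-∘ k h Γ)) (sym (pushTm-∘ k h a)) (sym (pushTy-∘ k h A)) D
  ⟦pushJ⟧⇒ (jTmEq Γ a b A) h k D =
    subst-⊢≣∶ (sym (pushCtx-∘ k h Γ)) (sym (pushTm-∘ k h a)) (sym (pushTm-∘ k h b))
              (sym (pushTy-∘ k h A)) D
  ⟦pushJ⟧⇒ (eTy X Y) h k e = trans (pushTy-∘ k h X) (trans e (sym (pushTy-∘ k h Y)))
  ⟦pushJ⟧⇒ (eTm X Y) h k e = trans (pushTm-∘ k h X) (trans e (sym (pushTm-∘ k h Y)))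
  ⟦pushJ⟧⇒ (eCell x y) h k e = trans (pushCell-∘ k h x) (trans e (sym (pushCell-∘ k h y)))
  ⟦pushJ⟧⇒ (j & j′) h k (p , q) = ⟦pushJ⟧⇒ j h k p , ⟦pushJ⟧⇒ j′ h k q

  ⟦⟧-stable : ∀ {c d e} (j : Judgement c) (h : Hom c d) (k : Hom d e) → ⟦ j ⟧ h → ⟦ j ⟧ (k ∘c h)
  ⟦⟧-stable j h k p = ⟦pushJ⟧⇒ j h k (⟦⟧-push j h k p)

  record Eventually {c} (j : Judgement c) : Set where
    constructor at
    field
      {stage} : Obj
      mor : Hom c stage
      holds : ⟦ j ⟧ mor

  _&&_ : ∀ {c} {j j′ : Judgement c} → Eventually j → Eventually j′ → Eventually (j & j′)
  _&&_ {j = j} {j′} (at h p) (at h′ q) with upper-bound _ _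
  ... | _ , f , g with coequalise (f ∘c h) (g ∘c h′)
  ... | _ , r , r∘f∘h≡r∘g∘h′ =
    at (r ∘c (f ∘c h))
       (⟦⟧-stable j _ r (⟦⟧-stable j h f p) ,
        subst (λ u → ⟦ j′ ⟧ u) (sym r∘f∘h≡r∘g∘h′) (⟦⟧-stable j′ _ r (⟦⟧-stable j′ h′ g q)))

  mapᴱ : ∀ {c} {j j′ : Judgement c} → Eventually j →
         (∀ {d} (k : Hom c d) → ⟦ j ⟧ k → ⟦ j′ ⟧ k) → Eventually j′
  mapᴱ (at h p) g = at h (g h p)

  pullᴱ : ∀ {c d} {j : Judgement c} (h : Hom c d) → Eventually (pushJ h j) → Eventually j
  pullᴱ {j = j} h (at k p) = at (k ∘c h) (⟦pushJ⟧⇒ j h k p)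

  module Colimit (A∞ : RGSet) (ι : ∀ a → RGHom A[ a ] A∞)
    (colimit : IsColimit 𝓘 (λ a → disc A[ a ]) (λ f → discHom A⟪ f ⟫) (disc A∞) (λ a → discHom (ι a)))
    where

    ιCell : ∀ a {k} → Cell a k → RGSet.Cell A∞ k
    ιCell a = RGHom.fun (ι a)

    ιTy : ∀ a {n} → Ty A[ a ] n → Ty A∞ n
    ιTy a = mapTy (ι a)

    ιTm : ∀ a {n} → Tm A[ a ] n → Tm A∞ n
    ιTm a = mapTm (ι a)

    ιCtx : ∀ a {n} → Ctx A[ a ] n → Ctx A∞ n
    ιCtx a = mapCtx (ι a)

    ιCell-push : ∀ {a b} (f : Hom a b) {k} (x : Cell a k) → ιCell b (pushCell f x) ≡ ιCell a x
    ιCell-push = IsColimit.commutes colimit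

    module _ {a b} (f : Hom a b) where
      private
        ιa≗ιb∘f : ∀ {k} (x : Cell a k) → ιCell a x ≡ ιCell b (pushCell f x)
        ιa≗ιb∘f x = sym (ιCell-push f x)

      ιTy-push : ∀ {n} (X : Ty A[ a ] n) → ιTy b (pushTy f X) ≡ ιTy a X
      ιTy-push X = sym (mapTy-∘ A⟪ f ⟫ (ι b) (ι a) ιa≗ιb∘f X)

      ιTm-push : ∀ {n} (X : Tm A[ a ] n) → ιTm b (pushTm f X) ≡ ιTm a X
      ιTm-push X = sym (mapTm-∘ A⟪ f ⟫ (ι b) (ι a) ιa≗ιb∘f X)

      ιCtx-push : ∀ {n} (Γ : Ctx A[ a ] n) → ιCtx b (pushCtx f Γ) ≡ ιCtx a Γ
      ιCtx-push Γ = sym (mapCtx-∘ A⟪ f ⟫ (ι b) (ι a) ιa≗ιb∘f Γ)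

      ιFrame-push : ∀ {n} (fr : RFrame A[ a ] n) →
                    mapFrame (ι b) (mapFrame A⟪ f ⟫ fr) ≡ mapFrame (ι a) fr
      ιFrame-push fr = sym (mapFrame-∘ A⟪ f ⟫ (ι b) (ι a) ιa≗ιb∘f fr)

    -- The filtered colimit of the cells, built by hand; comparing it with A∞ shows that
    -- A∞ has no other cells and no other identifications.
    Germ : ℕ → Set
    Germ n = Σ Obj λ a → Cell a n

    _∼_ : ∀ {n} → Germ n → Germ n → Set
    (a , x) ∼ (b , y) = Σ Obj λ d → Σ (Hom a d) λ f → Σ (Hom b d) λ g → pushCell f x ≡ pushCell g y

    ∼-refl : ∀ {n} {u : Germ n} → u ∼ u
    ∼-refl {u = a , _} = a , idc , idc , refl

    ∼-sym : ∀ {n} {u v : Germ n} → u ∼ v → v ∼ u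
    ∼-sym (d , f , g , e) = d , g , f , sym e

    ∼-trans : ∀ {n} {u v w : Germ n} → u ∼ v → v ∼ w → u ∼ w
    ∼-trans {u = _ , x} {_ , y} {_ , z} (d , f , g , fx≡gy) (d′ , f′ , g′ , f′y≡g′z)
      with upper-bound d d′
    ... | _ , p , q with coequalise (p ∘c g) (q ∘c f′)
    ... | _ , r , r∘p∘g≡r∘q∘f′ = _ , r ∘c (p ∘c f) , r ∘c (q ∘c g′) , chain
      where
      open ≡-Reasoning
      chain : pushCell (r ∘c (p ∘c f)) x ≡ pushCell (r ∘c (q ∘c g′)) z
      chain = begin
        pushCell (r ∘c (p ∘c f)) x     ≡⟨ trans (pushCell-∘ r _ x) (cong (pushCell r) (pushCell-∘ p f x)) ⟩
        pushCell r (pushCell p (pushCell f x)) ≡⟨ cong (λ w → pushCell r (pushCell p w)) fx≡gy ⟩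
        pushCell r (pushCell p (pushCell g y)) ≡⟨ sym (trans (pushCell-∘ r _ y) (cong (pushCell r) (pushCell-∘ p g y))) ⟩
        pushCell (r ∘c (p ∘c g)) y     ≡⟨ cong (λ h → pushCell h y) r∘p∘g≡r∘q∘f′ ⟩
        pushCell (r ∘c (q ∘c f′)) y    ≡⟨ trans (pushCell-∘ r _ y) (cong (pushCell r) (pushCell-∘ q f′ y)) ⟩
        pushCell r (pushCell q (pushCell f′ y)) ≡⟨ cong (λ w → pushCell r (pushCell q w)) f′y≡g′z ⟩
        pushCell r (pushCell q (pushCell g′ z)) ≡⟨ sym (trans (pushCell-∘ r _ z) (cong (pushCell r) (pushCell-∘ q g′ z))) ⟩
        pushCell (r ∘c (q ∘c g′)) z    ∎

    private
      push-∼ : ∀ {m n} (op : ∀ {c} → Cell c m → Cell c n)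
               (op-natural : ∀ {c d} (f : Hom c d) x → pushCell f (op x) ≡ op (pushCell f x))
               {u v : Germ m} → u ∼ v → (proj₁ u , op (proj₂ u)) ∼ (proj₁ v , op (proj₂ v))
      push-∼ op op-natural {_ , x} {_ , y} (d , f , g , e) =
        d , f , g , trans (op-natural f x) (trans (cong op e) (sym (op-natural g y)))

      ∼-of-≡ : ∀ {a n} {x y : Cell a n} → x ≡ y → (a , x) ∼ (a , y)
      ∼-of-≡ refl = ∼-refl

    germs : SRGSet
    germs = record
      { Cell = Germ ; _≈_ = _∼_
      ; isEquivalence = record { refl = ∼-refl ; sym = ∼-sym ; trans = ∼-trans }
      ; s = λ (a , x) → a , RGSet.s A[ a ] x
      ; t = λ (a , x) → a , RGSet.t A[ a ] x
      ; i = λ (a , x) → a , RGSet.i A[ a ] x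
      ; s-cong = push-∼ (λ {c} → RGSet.s A[ c ]) (λ f → RGHom.fun-s A⟪ f ⟫)
      ; t-cong = push-∼ (λ {c} → RGSet.t A[ c ]) (λ f → RGHom.fun-t A⟪ f ⟫)
      ; i-cong = push-∼ (λ {c} → RGSet.i A[ c ]) (λ f → RGHom.fun-i A⟪ f ⟫)
      ; ss≈st = λ (a , x) → ∼-of-≡ (RGSet.ss≡st A[ a ] x)
      ; ts≈tt = λ (a , x) → ∼-of-≡ (RGSet.ts≡tt A[ a ] x)
      ; si≈id = λ (a , x) → ∼-of-≡ (RGSet.si≡id A[ a ] x)
      ; ti≈id = λ (a , x) → ∼-of-≡ (RGSet.ti≡id A[ a ] x) }

    germ : ∀ a → SRGHom (disc A[ a ]) germs
    germ a = record
      { fun = λ x → a , x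
      ; fun-cong = ∼-of-≡
      ; fun-s = λ _ → ∼-refl ; fun-t = λ _ → ∼-refl ; fun-i = λ _ → ∼-refl }

    private
      germ-compatible : ∀ {a b} (f : Hom a b) {n} (x : Cell a n) → (b , pushCell f x) ∼ (a , x)
      germ-compatible {b = b} f x = b , idc , f , Functor.hom-id A (pushCell f x)

      toGerm : SRGHom (disc A∞) germs
      toGerm = proj₁ (IsColimit.universal colimit germs germ germ-compatible)

      toGerm-ι : ∀ a {n} (x : Cell a n) → SRGHom.fun toGerm (ιCell a x) ∼ (a , x)
      toGerm-ι = proj₁ (proj₂ (IsColimit.universal colimit germs germ germ-compatible))

    ιCell-reflects-≡ : ∀ {c k} {x y : Cell c k} → ιCell c x ≡ ιCell c y →
                       Σ Obj λ d → Σ (Hom c d) λ h → pushCell h x ≡ pushCell h y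
    ιCell-reflects-≡ {c} {x = x} {y} ιx≡ιy
      with ∼-trans (∼-sym (toGerm-ι c x)) (subst (λ w → SRGHom.fun toGerm w ∼ (c , y)) (sym ιx≡ιy) (toGerm-ι c y))
    ... | _ , f , g , fx≡gy with coequalise f g
    ... | _ , r , r∘f≡r∘g = _ , r ∘c f ,
      trans (pushCell-∘ r f x) (trans (cong (pushCell r) fx≡gy)
        (trans (sym (pushCell-∘ r g y)) (cong (λ h → pushCell h y) (sym r∘f≡r∘g))))

    private
      fromGerm : SRGHom germs (disc A∞)
      fromGerm = record
        { fun = λ (a , x) → ιCell a x
        ; fun-cong = λ { {x = _ , x} {_ , y} (_ , f , g , fx≡gy) →
            trans (sym (ιCell-push f x)) (trans (cong (ιCell _) fx≡gy) (ιCell-push g y)) }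
        ; fun-s = λ (a , x) → RGHom.fun-s (ι a) x
        ; fun-t = λ (a , x) → RGHom.fun-t (ι a) x
        ; fun-i = λ (a , x) → RGHom.fun-i (ι a) x }

      fromGerm∘toGerm : SRGHom (disc A∞) (disc A∞)
      fromGerm∘toGerm = record
        { fun = λ x → SRGHom.fun fromGerm (SRGHom.fun toGerm x)
        ; fun-cong = λ e → SRGHom.fun-cong fromGerm (SRGHom.fun-cong toGerm e)
        ; fun-s = λ x → trans (SRGHom.fun-cong fromGerm (SRGHom.fun-s toGerm x)) (SRGHom.fun-s fromGerm _)
        ; fun-t = λ x → trans (SRGHom.fun-cong fromGerm (SRGHom.fun-t toGerm x)) (SRGHom.fun-t fromGerm _)
        ; fun-i = λ x → trans (SRGHom.fun-cong fromGerm (SRGHom.fun-i toGerm x)) (SRGHom.fun-i fromGerm _) }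

      idA∞ : SRGHom (disc A∞) (disc A∞)
      idA∞ = record { fun = λ x → x ; fun-cong = λ e → e
                    ; fun-s = λ _ → refl ; fun-t = λ _ → refl ; fun-i = λ _ → refl }

    ιCell-surjective : ∀ {k} (α : RGSet.Cell A∞ k) → Σ Obj λ a → Σ (Cell a k) λ x → ιCell a x ≡ α
    ιCell-surjective α = proj₁ (SRGHom.fun toGerm α) , proj₂ (SRGHom.fun toGerm α) ,
      colimit-endo-unique colimit fromGerm∘toGerm idA∞
        (λ a x → SRGHom.fun-cong fromGerm (toGerm-ι a x)) (λ _ _ → refl) α

    reflect-≡Cell : ∀ {c k} (x y : Cell c k) → ιCell c x ≡ ιCell c y → Eventually (eCell x y)
    reflect-≡Cell x y ιx≡ιy with ιCell-reflects-≡ ιx≡ιy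
    ... | _ , h , hx≡hy = at h hx≡hy

    mutual
      reflect-≡Ty : ∀ {c n} (X Y : Ty A[ c ] n) → ιTy c X ≡ ιTy c Y → Eventually (eTy X Y)
      reflect-≡Ty `G `G _ = at idc refl
      reflect-≡Ty `ℕ `ℕ _ = at idc refl
      reflect-≡Ty (`Π A B) (`Π A′ B′) e with Π-injective e
      ... | eA , eB = mapᴱ (reflect-≡Ty A A′ eA && reflect-≡Ty B B′ eB) λ { _ (p , q) → cong₂ `Π p q }
      reflect-≡Ty (`Σ A B) (`Σ A′ B′) e with Σ-injective e
      ... | eA , eB = mapᴱ (reflect-≡Ty A A′ eA && reflect-≡Ty B B′ eB) λ { _ (p , q) → cong₂ `Σ p q }
      reflect-≡Ty (`Id A a b) (`Id A′ a′ b′) e with Id-injective e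
      ... | eA , ea , eb =
        mapᴱ (reflect-≡Ty A A′ eA && reflect-≡Tm a a′ ea && reflect-≡Tm b b′ eb)
          λ { _ (p , q , r) → cong-Id p q r }

      reflect-≡Tm : ∀ {c n} (X Y : Tm A[ c ] n) → ιTm c X ≡ ιTm c Y → Eventually (eTm X Y)
      reflect-≡Tm (var x) (var .x) refl = at idc refl
      reflect-≡Tm ze ze _ = at idc refl
      reflect-≡Tm (lam b) (lam b′) e = mapᴱ (reflect-≡Tm b b′ (lam-injective e)) λ _ → cong lam
      reflect-≡Tm (rfl a) (rfl a′) e = mapᴱ (reflect-≡Tm a a′ (rfl-injective e)) λ _ → cong rfl
      reflect-≡Tm (su a) (su a′) e = mapᴱ (reflect-≡Tm a a′ (su-injective e)) λ _ → cong su
      reflect-≡Tm (app f a) (app f′ a′) e with app-injective e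
      ... | ef , ea = mapᴱ (reflect-≡Tm f f′ ef && reflect-≡Tm a a′ ea) λ { _ (p , q) → cong₂ app p q }
      reflect-≡Tm (pair a b) (pair a′ b′) e with pair-injective e
      ... | ea , eb = mapᴱ (reflect-≡Tm a a′ ea && reflect-≡Tm b b′ eb) λ { _ (p , q) → cong₂ pair p q }
      reflect-≡Tm (split C c p) (split C′ c′ p′) e with split-injective e
      ... | eC , ec , ep =
        mapᴱ (reflect-≡Ty C C′ eC && reflect-≡Tm c c′ ec && reflect-≡Tm p p′ ep)
          λ { _ (q , r , s) → cong-split q r s }
      reflect-≡Tm (J C d a b p) (J C′ d′ a′ b′ p′) e with J-injective e
      ... | eC , ed , ea , eb , ep =
        mapᴱ (reflect-≡Ty C C′ eC && reflect-≡Tm d d′ ed && reflect-≡Tm a a′ ea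
              && reflect-≡Tm b b′ eb && reflect-≡Tm p p′ ep)
          λ { _ (q , r , s , t , u) → cong-J q r s t u }
      reflect-≡Tm (natrec C z c a) (natrec C′ z′ c′ a′) e with natrec-injective e
      ... | eC , ez , ec , ea =
        mapᴱ (reflect-≡Ty C C′ eC && reflect-≡Tm z z′ ez && reflect-≡Tm c c′ ec && reflect-≡Tm a a′ ea)
          λ { _ (q , r , s , t) → cong-natrec q r s t }
      reflect-≡Tm (const x) (const y) e with const-injective e
      ... | refl , ιx≡ιy = mapᴱ (reflect-≡Cell x y ιx≡ιy) λ _ → cong const

    record Cocone : Set₁ where
      field
        F₀ : Obj → Set
        F₁ : ∀ {a b} → Hom a b → F₀ a → F₀ b
        Apex : Set
        leg : ∀ a → F₀ a → Apex
        leg-natural : ∀ {a b} (f : Hom a b) (x : F₀ a) → leg b (F₁ f x) ≡ leg a x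

    record InImage (K : Cocone) (t : Cocone.Apex K) : Set where
      constructor image
      open Cocone K
      field
        stage : Obj
        elem : F₀ stage
        leg≡ : leg stage elem ≡ t

    _⊗_ : Cocone → Cocone → Cocone
    K ⊗ L = record
      { F₀ = λ a → K.F₀ a × L.F₀ a
      ; F₁ = λ f (x , y) → K.F₁ f x , L.F₁ f y
      ; Apex = K.Apex × L.Apex
      ; leg = λ a (x , y) → K.leg a x , L.leg a y
      ; leg-natural = λ f (x , y) → cong₂ _,_ (K.leg-natural f x) (L.leg-natural f y) }
      where
      module K = Cocone K
      module L = Cocone L

    inImage-⊗ : ∀ {K L t u} → InImage K t → InImage L u → InImage (K ⊗ L) (t , u)
    inImage-⊗ {K} {L} (image a x x↦t) (image b y y↦u) with upper-bound a b
    ... | _ , f , g = image _ (Cocone.F₁ K f x , Cocone.F₁ L g y)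
                        (cong₂ _,_ (trans (Cocone.leg-natural K f x) x↦t) (trans (Cocone.leg-natural L g y) y↦u))

    inImage-map : ∀ {K K′ t} → InImage K t →
                  (g : ∀ {a} → Cocone.F₀ K a → Cocone.F₀ K′ a) (g∞ : Cocone.Apex K → Cocone.Apex K′) →
                  (∀ a x → Cocone.leg K′ a (g x) ≡ g∞ (Cocone.leg K a x)) → InImage K′ (g∞ t)
    inImage-map (image a x x↦t) g g∞ g-natural = image a (g x) (trans (g-natural a x) (cong g∞ x↦t))

    TyCocone : ℕ → Cocone
    TyCocone n = record { F₀ = λ a → Ty A[ a ] n ; F₁ = λ f → pushTy f ; Apex = Ty A∞ n
                        ; leg = λ a → ιTy a ; leg-natural = λ f → ιTy-push f }

    TmCocone : ℕ → Cocone
    TmCocone n = record { F₀ = λ a → Tm A[ a ] n ; F₁ = λ f → pushTm f ; Apex = Tm A∞ n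
                        ; leg = λ a → ιTm a ; leg-natural = λ f → ιTm-push f }

    FrameCocone : ℕ → Cocone
    FrameCocone n = record { F₀ = λ a → RFrame A[ a ] n ; F₁ = λ f → mapFrame A⟪ f ⟫ ; Apex = RFrame A∞ n
                           ; leg = λ a → mapFrame (ι a) ; leg-natural = λ f → ιFrame-push f }

    -- Each constructor is the same function of its arguments at every stage, hence commutes with ι.
    mutual
      Ty-inImage : ∀ {n} (X : Ty A∞ n) → InImage (TyCocone n) X
      Ty-inImage `G = image nonempty `G refl
      Ty-inImage `ℕ = image nonempty `ℕ refl
      Ty-inImage (`Π A B) =
        inImage-map (inImage-⊗ (Ty-inImage A) (Ty-inImage B))
          (λ (A , B) → `Π A B) (λ (A , B) → `Π A B) (λ _ _ → refl)
      Ty-inImage (`Σ A B) =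
        inImage-map (inImage-⊗ (Ty-inImage A) (Ty-inImage B))
          (λ (A , B) → `Σ A B) (λ (A , B) → `Σ A B) (λ _ _ → refl)
      Ty-inImage (`Id A a b) =
        inImage-map (inImage-⊗ (Ty-inImage A) (inImage-⊗ (Tm-inImage a) (Tm-inImage b)))
          (λ (A , a , b) → `Id A a b) (λ (A , a , b) → `Id A a b) (λ _ _ → refl)

      Tm-inImage : ∀ {n} (X : Tm A∞ n) → InImage (TmCocone n) X
      Tm-inImage (var x) = image nonempty (var x) refl
      Tm-inImage ze = image nonempty ze refl
      Tm-inImage (lam b) = inImage-map (Tm-inImage b) lam lam (λ _ _ → refl)
      Tm-inImage (rfl a) = inImage-map (Tm-inImage a) rfl rfl (λ _ _ → refl)
      Tm-inImage (su a) = inImage-map (Tm-inImage a) su su (λ _ _ → refl)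
      Tm-inImage (app f a) =
        inImage-map (inImage-⊗ (Tm-inImage f) (Tm-inImage a))
          (λ (f , a) → app f a) (λ (f , a) → app f a) (λ _ _ → refl)
      Tm-inImage (pair a b) =
        inImage-map (inImage-⊗ (Tm-inImage a) (Tm-inImage b))
          (λ (a , b) → pair a b) (λ (a , b) → pair a b) (λ _ _ → refl)
      Tm-inImage (split C c p) =
        inImage-map (inImage-⊗ (Ty-inImage C) (inImage-⊗ (Tm-inImage c) (Tm-inImage p)))
          (λ (C , c , p) → split C c p) (λ (C , c , p) → split C c p) (λ _ _ → refl)
      Tm-inImage (J C d a b p) =
        inImage-map
          (inImage-⊗ (Ty-inImage C) (inImage-⊗ (Tm-inImage d)
            (inImage-⊗ (Tm-inImage a) (inImage-⊗ (Tm-inImage b) (Tm-inImage p)))))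
          (λ (C , d , a , b , p) → J C d a b p) (λ (C , d , a , b , p) → J C d a b p) (λ _ _ → refl)
      Tm-inImage (natrec C z c a) =
        inImage-map (inImage-⊗ (Ty-inImage C) (inImage-⊗ (Tm-inImage z) (inImage-⊗ (Tm-inImage c) (Tm-inImage a))))
          (λ (C , z , c , a) → natrec C z c a) (λ (C , z , c , a) → natrec C z c a) (λ _ _ → refl)
      Tm-inImage (const α) with ιCell-surjective α
      ... | a , x , ιx≡α = image a (const x) (cong const ιx≡α)

    Frame-inImage : ∀ {n} (fr : RFrame A∞ n) → InImage (FrameCocone n) fr
    Frame-inImage {zero} tt = image nonempty tt refl
    Frame-inImage {suc n} (fr , b₀ , b₁) =
      inImage-map (inImage-⊗ (Frame-inImage fr) (inImage-⊗ (Tm-inImage b₀) (Tm-inImage b₁)))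
        (λ x → x) (λ x → x) (λ _ _ → refl)

    liftTy-above : ∀ {n} c (X : Ty A∞ n) →
                   Σ Obj λ d → Σ (Hom c d) λ h → Σ (Ty A[ d ] n) λ X′ → ιTy d X′ ≡ X
    liftTy-above c X with Ty-inImage X
    ... | image a X′ ιX′≡X with upper-bound c a
    ... | d , h , g = d , h , pushTy g X′ , trans (ιTy-push g X′) ιX′≡X

    liftTm-above : ∀ {n} c (X : Tm A∞ n) →
                   Σ Obj λ d → Σ (Hom c d) λ h → Σ (Tm A[ d ] n) λ X′ → ιTm d X′ ≡ X
    liftTm-above c X with Tm-inImage X
    ... | image a X′ ιX′≡X with upper-bound c a
    ... | d , h , g = d , h , pushTm g X′ , trans (ιTm-push g X′) ιX′≡X

    mutual
      lift-⊢ : ∀ {n} {Γ : Ctx A∞ n} → ⊢ Γ → ∀ {c} (Γ′ : Ctx A[ c ] n) →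
               ιCtx c Γ′ ≡ Γ → Eventually (jCtx Γ′)
      lift-⊢ ⊢ε ε refl = at idc ⊢ε
      lift-⊢ (⊢▸ g Ad) (Γ′ ▸ A′) refl =
        mapᴱ (lift-⊢ g Γ′ refl && lift-⊢Ty Ad Γ′ A′ refl refl) λ { k (D1 , D2) → ⊢▸ D1 D2 }

      lift-⊢Ty : ∀ {n} {Γ : Ctx A∞ n} {A} → Γ ⊢Ty A → ∀ {c} (Γ′ : Ctx A[ c ] n) A′ →
                 ιCtx c Γ′ ≡ Γ → ιTy c A′ ≡ A → Eventually (jTy Γ′ A′)
      lift-⊢Ty (G-F g) Γ′ `G refl refl = mapᴱ (lift-⊢ g Γ′ refl) λ k D → G-F D
      lift-⊢Ty (ℕ-F g) Γ′ `ℕ refl refl = mapᴱ (lift-⊢ g Γ′ refl) λ k D → ℕ-F D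
      lift-⊢Ty (Π-F Ad Bd) Γ′ (`Π A′ B′) refl refl =
        mapᴱ (lift-⊢Ty Ad Γ′ A′ refl refl
            && lift-⊢Ty Bd (Γ′ ▸ A′) B′ refl refl) λ { k (D1 , D2) → Π-F D1 D2 }
      lift-⊢Ty (Σ-F Ad Bd) Γ′ (`Σ A′ B′) refl refl =
        mapᴱ (lift-⊢Ty Ad Γ′ A′ refl refl
            && lift-⊢Ty Bd (Γ′ ▸ A′) B′ refl refl) λ { k (D1 , D2) → Σ-F D1 D2 }
      lift-⊢Ty (Id-F Ad ad bd) Γ′ (`Id A′ a′ b′) refl refl =
        mapᴱ (lift-⊢Ty Ad Γ′ A′ refl refl && lift-⊢∶ ad Γ′ a′ A′ refl refl refl
            && lift-⊢∶ bd Γ′ b′ A′ refl refl refl)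
          λ { k (D1 , D2 , D3) → Id-F D1 D2 D3 }

      lift-⊢≣Ty : ∀ {n} {Γ : Ctx A∞ n} {A B} → Γ ⊢ A ≣Ty B →
                  ∀ {c} (Γ′ : Ctx A[ c ] n) A′ B′ → ιCtx c Γ′ ≡ Γ →
                  ιTy c A′ ≡ A → ιTy c B′ ≡ B → Eventually (jTyEq Γ′ A′ B′)
      lift-⊢≣Ty (ty-refl Ad) Γ′ A′ B′ refl refl eB =
        mapᴱ (lift-⊢Ty Ad Γ′ A′ refl refl
            && reflect-≡Ty A′ B′ (sym eB)) λ { k (D , e) → subst-⊢≣Ty refl refl e (ty-refl D) }
      lift-⊢≣Ty (ty-sym e) Γ′ A′ B′ refl refl refl = mapᴱ (lift-⊢≣Ty e Γ′ B′ A′ refl refl refl)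
          λ k D → ty-sym D
      lift-⊢≣Ty (ty-trans {B = Bₓ} e1 e2) {c} Γ′ A′ C′ refl refl refl with liftTy-above c Bₓ
      ... | d , h , B′ , eB = pullᴱ h (mapᴱ
            (lift-⊢≣Ty e1 (pushCtx h Γ′) (pushTy h A′) B′ (ιCtx-push h Γ′) (ιTy-push h A′) eB
             && lift-⊢≣Ty e2 (pushCtx h Γ′) B′ (pushTy h C′) (ιCtx-push h Γ′) eB (ιTy-push h C′))
            λ { k (D1 , D2) → ty-trans D1 D2 })
      lift-⊢≣Ty (Π-cong Ad e1 e2) Γ′ (`Π A1 B1) (`Π A2 B2) refl refl refl =
        mapᴱ (lift-⊢Ty Ad Γ′ A1 refl refl && lift-⊢≣Ty e1 Γ′ A1 A2 refl refl refl
            && lift-⊢≣Ty e2 (Γ′ ▸ A1) B1 B2 refl refl refl)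
          λ { k (D1 , D2 , D3) → Π-cong D1 D2 D3 }
      lift-⊢≣Ty (Σ-cong Ad e1 e2) Γ′ (`Σ A1 B1) (`Σ A2 B2) refl refl refl =
        mapᴱ (lift-⊢Ty Ad Γ′ A1 refl refl && lift-⊢≣Ty e1 Γ′ A1 A2 refl refl refl
            && lift-⊢≣Ty e2 (Γ′ ▸ A1) B1 B2 refl refl refl)
          λ { k (D1 , D2 , D3) → Σ-cong D1 D2 D3 }
      lift-⊢≣Ty (Id-cong e ea eb) Γ′ (`Id A1 a1 b1) (`Id A2 a2 b2) refl refl refl =
        mapᴱ (lift-⊢≣Ty e Γ′ A1 A2 refl refl refl && lift-⊢≣∶ ea Γ′ a1 a2 A1 refl refl refl refl
              && lift-⊢≣∶ eb Γ′ b1 b2 A1 refl refl refl refl)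
          λ { k (D1 , D2 , D3) → Id-cong D1 D2 D3 }

      lift-⊢∶ : ∀ {n} {Γ : Ctx A∞ n} {a A} → Γ ⊢ a ∶ A →
                ∀ {c} (Γ′ : Ctx A[ c ] n) a′ A′ → ιCtx c Γ′ ≡ Γ →
                ιTm c a′ ≡ a → ιTy c A′ ≡ A → Eventually (jTm Γ′ a′ A′)
      lift-⊢∶ (var g x) {c} Γ′ (var _) A′ refl refl eA =
        mapᴱ (lift-⊢ g Γ′ refl && reflect-≡Ty A′ (lookup A[ c ] Γ′ x) (trans eA (sym (map-lookup
            (ι c) Γ′ x))))
          λ { k (D , e) → retype-∶ (sym (trans e (map-lookup A⟪ k ⟫ Γ′ x))) (var D x) }
      lift-⊢∶ (conv {A = Aₓ} ad e) {c} Γ′ a′ B′ refl refl refl with liftTy-above c Aₓ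
      ... | d , h , A′ , eA = pullᴱ h (mapᴱ
            (lift-⊢∶ ad (pushCtx h Γ′) (pushTm h a′) A′ (ιCtx-push h Γ′) (ιTm-push h a′) eA
             && lift-⊢≣Ty e (pushCtx h Γ′) A′ (pushTy h B′) (ιCtx-push h Γ′) eA (ιTy-push h B′))
            λ { k (D1 , D2) → conv D1 D2 })
      lift-⊢∶ (lam Ad bd) Γ′ (lam b′) (`Π A′ B′) refl refl refl =
        mapᴱ (lift-⊢Ty Ad Γ′ A′ refl refl
            && lift-⊢∶ bd (Γ′ ▸ A′) b′ B′ refl refl refl) λ { k (D1 , D2) → lam D1 D2 }
      lift-⊢∶ (app {A = Aₓ} {B = Bₓ} fd ad) {c} Γ′ (app f′ a′) X′ refl refl eX with liftTy-above c
          (`Π Aₓ Bₓ)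
      ... | d , h , `Π A′ B′ , eP with Π-injective eP
      ... | eA , eB = pullᴱ h (mapᴱ
            (lift-⊢∶ fd (pushCtx h Γ′) (pushTm h f′) (`Π A′ B′) (ιCtx-push h Γ′) (ιTm-push h f′) eP
             && lift-⊢∶ ad (pushCtx h Γ′) (pushTm h a′) A′ (ιCtx-push h Γ′) (ιTm-push h a′) eA
             && reflect-≡Ty (pushTy h X′) (B′ [ pushTm h a′ ]₀)
                  (trans (ιTy-push h X′) (trans eX (sym (trans (map-[]₀ (ι d) B′ (pushTm h a′))
                      (cong₂ _[_]₀ eB (ιTm-push h a′)))))))
            λ { k (D1 , D2 , e) → retype-∶ (sym (trans e (map-[]₀ A⟪ k ⟫ B′ (pushTm h a′)))) (app D1 D2) })
      lift-⊢∶ (pair Ad Bd ad bd) {c} Γ′ (pair a′ b′) (`Σ A′ B′) refl refl refl =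
        mapᴱ (lift-⊢Ty Ad Γ′ A′ refl refl && lift-⊢Ty Bd (Γ′ ▸ A′) B′ refl refl
            && lift-⊢∶ ad Γ′ a′ A′ refl refl refl
              && lift-⊢∶ bd Γ′ b′ (B′ [ a′ ]₀) refl refl (map-[]₀ (ι c) B′ a′))
          λ { k (D1 , D2 , D3 , D4) → pair D1 D2 D3 (retype-∶ (map-[]₀ A⟪ k ⟫ B′ a′) D4) }
      lift-⊢∶ (split {A = Aₓ} {B = Bₓ} Cd cd pd) {c} Γ′
          (split C′ c′ p′) X′ refl refl eX with liftTy-above c (`Σ Aₓ Bₓ)
      ... | d , h , `Σ A′ B′ , eS with Σ-injective eS
      ... | eA , eB = pullᴱ h (mapᴱ
            (lift-⊢Ty Cd (pushCtx h Γ′ ▸ `Σ A′ B′) (pushTy h C′) (cong₂ _▸_ (ιCtx-push h Γ′) eS)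
                (ιTy-push h C′)
             && lift-⊢∶ cd (pushCtx h Γ′ ▸ A′ ▸ B′) (pushTm h c′) (subTy (wk2S ∷ₛ pair v1 v0) (pushTy h C′))
                  (cong₂ _▸_ (cong₂ _▸_ (ιCtx-push h Γ′) eA) eB) (ιTm-push h c′)
                  (trans (map-splitTy (ι d) (pushTy h C′)) (cong (subTy _) (ιTy-push h C′)))
             && lift-⊢∶ pd (pushCtx h Γ′) (pushTm h p′) (`Σ A′ B′) (ιCtx-push h Γ′) (ιTm-push h p′) eS
             && reflect-≡Ty (pushTy h X′) (pushTy h C′ [ pushTm h p′ ]₀)
                  (trans (ιTy-push h X′) (trans eX (sym (trans (map-[]₀ (ι d) (pushTy h C′) (pushTm h p′))
                     (cong₂ _[_]₀ (ιTy-push h C′) (ιTm-push h p′)))))))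
            λ { k (D1 , D2 , D3 , e) → retype-∶ (sym (trans e (map-[]₀ A⟪ k ⟫ _ _)))
                  (split D1 (retype-∶ (map-splitTy A⟪ k ⟫ _) D2) D3) })
      lift-⊢∶ (rfl ad) Γ′ (rfl a′) (`Id A′ u v) refl refl eX with Id-injective eX
      ... | eA , e1 , e2 =
        mapᴱ (lift-⊢∶ ad Γ′ a′ A′ refl refl eA && reflect-≡Tm u a′ e1 && reflect-≡Tm v a′ e2)
          λ { k (D , p , q) → retype-∶ (cong-Id refl (sym p) (sym q)) (rfl D) }
      lift-⊢∶ (J {A = Aₓ} Cd dd ad bd pd) {c} Γ′ (J C′ d′ a′ b′ p′) X′ refl refl eX with liftTy-above c Aₓ
      ... | d , h , A′ , eA = pullᴱ h (mapᴱ
            (lift-⊢Ty Cd (JCtx (pushCtx h Γ′) A′) (pushTy h C′) (trans (map-JCtx (ι d) _ A′) (cong-JCtx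
                (ιCtx-push h Γ′) eA)) (ιTy-push h C′)
             && lift-⊢∶ dd (pushCtx h Γ′ ▸ A′) (pushTm h d′) (subTy (wkS ∷ₛ v0 ∷ₛ v0 ∷ₛ rfl v0)
                 (pushTy h C′))
                  (cong₂ _▸_ (ιCtx-push h Γ′) eA) (ιTm-push h d′) (trans (map-JbaseTy (ι d) _) (cong
                      (subTy _) (ιTy-push h C′)))
             && lift-⊢∶ ad (pushCtx h Γ′) (pushTm h a′) A′ (ιCtx-push h Γ′) (ιTm-push h a′) eA
             && lift-⊢∶ bd (pushCtx h Γ′) (pushTm h b′) A′ (ιCtx-push h Γ′) (ιTm-push h b′) eA
             && lift-⊢∶ pd (pushCtx h Γ′) (pushTm h p′) (`Id A′ (pushTm h a′) (pushTm h b′))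
                 (ιCtx-push h Γ′) (ιTm-push h p′)
                  (cong-Id eA (ιTm-push h a′) (ιTm-push h b′))
             && reflect-≡Ty (pushTy h X′) (subTy (idS ∷ₛ pushTm h a′ ∷ₛ pushTm h b′ ∷ₛ pushTm h p′)
                 (pushTy h C′))
                  (trans (ιTy-push h X′) (trans eX (sym (trans (map-sub₃Ty (ι d) _ _ _ _)
                     (cong-sub₃Ty (ιTy-push h C′) (ιTm-push h a′) (ιTm-push h b′) (ιTm-push h p′)))))))
            λ { k (D1 , D2 , D3 , D4 , D5 , e) → retype-∶ (sym (trans e (map-sub₃Ty A⟪ k ⟫ _ _ _ _)))
                  (J (subst-⊢Ty (map-JCtx A⟪ k ⟫ _ _) refl D1) (retype-∶
                      (map-JbaseTy A⟪ k ⟫ _) D2) D3 D4 D5) })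
      lift-⊢∶ (ze g) Γ′ ze `ℕ refl refl refl = mapᴱ (lift-⊢ g Γ′ refl) λ k D → ze D
      lift-⊢∶ (su ad) Γ′ (su a′) `ℕ refl refl refl =
        mapᴱ (lift-⊢∶ ad Γ′ a′ `ℕ refl refl refl) λ k D → su D
      lift-⊢∶ (natrec Cd zd cd ad) {c} Γ′ (natrec C′ z′ c′ a′) X′ refl refl eX =
        mapᴱ (lift-⊢Ty Cd (Γ′ ▸ `ℕ) C′ refl refl
              && lift-⊢∶ zd Γ′ z′ (C′ [ ze ]₀) refl refl (map-[]₀ (ι c) C′ ze)
              && lift-⊢∶ cd (Γ′ ▸ `ℕ ▸ C′) c′ (subTy (wk2S ∷ₛ su v1) C′) refl refl (map-natrecTy (ι c) C′)
              && lift-⊢∶ ad Γ′ a′ `ℕ refl refl refl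
              && reflect-≡Ty X′ (C′ [ a′ ]₀) (trans eX (sym (map-[]₀ (ι c) C′ a′))))
          λ { k (D1 , D2 , D3 , D4 , e) → retype-∶ (sym (trans e (map-[]₀ A⟪ k ⟫ C′ a′)))
                (natrec D1 (retype-∶ (map-[]₀ A⟪ k ⟫ C′ ze) D2) (retype-∶ (map-natrecTy A⟪ k ⟫ C′) D3) D4) }
      lift-⊢∶ (const g _) {c} Γ′ (const x) X′ refl refl eX =
        mapᴱ (lift-⊢ g Γ′ refl && reflect-≡Ty X′ (cellTy A[ c ] x) (trans eX (sym (map-cellTy (ι c) x))))
          λ { k (D , e) → retype-∶ (sym (trans e (map-cellTy A⟪ k ⟫ x))) (const D (pushCell k x)) }

      lift-⊢≣∶ : ∀ {n} {Γ : Ctx A∞ n} {a b A} → Γ ⊢ a ≣ b ∶ A →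
                 ∀ {c} (Γ′ : Ctx A[ c ] n) a′ b′ A′ → ιCtx c Γ′ ≡ Γ →
                 ιTm c a′ ≡ a → ιTm c b′ ≡ b → ιTy c A′ ≡ A → Eventually (jTmEq Γ′ a′ b′ A′)
      lift-⊢≣∶ (tm-refl ad) Γ′ a′ b′ A′ refl refl eb refl =
        mapᴱ (lift-⊢∶ ad Γ′ a′ A′ refl refl refl
            && reflect-≡Tm a′ b′ (sym eb)) λ { k (D , e) → subst-⊢≣∶ refl refl e refl (tm-refl D) }
      lift-⊢≣∶ (tm-sym e) Γ′ a′ b′ A′ refl refl refl refl =
        mapᴱ (lift-⊢≣∶ e Γ′ b′ a′ A′ refl refl refl refl) λ k D → tm-sym D
      lift-⊢≣∶ (tm-trans {b = bₓ} e1 e2) {c} Γ′ a′ c′ A′ refl refl refl refl with liftTm-above c bₓ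
      ... | d , h , b′ , eb = pullᴱ h (mapᴱ
            (lift-⊢≣∶ e1 (pushCtx h Γ′) (pushTm h a′) b′ (pushTy h A′) (ιCtx-push h Γ′)
                (ιTm-push h a′) eb (ιTy-push h A′)
             && lift-⊢≣∶ e2 (pushCtx h Γ′) b′ (pushTm h c′) (pushTy h A′) (ιCtx-push h Γ′) eb
                 (ιTm-push h c′) (ιTy-push h A′))
            λ { k (D1 , D2) → tm-trans D1 D2 })
      lift-⊢≣∶ (conv {A = Aₓ} e e′) {c} Γ′ a′ b′ B′ refl refl refl refl with liftTy-above c Aₓ
      ... | d , h , A′ , eA = pullᴱ h (mapᴱ
            (lift-⊢≣∶ e (pushCtx h Γ′) (pushTm h a′) (pushTm h b′) A′ (ιCtx-push h Γ′) (ιTm-push h a′)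
                (ιTm-push h b′) eA
             && lift-⊢≣Ty e′ (pushCtx h Γ′) A′ (pushTy h B′) (ιCtx-push h Γ′) eA (ιTy-push h B′))
            λ { k (D1 , D2) → conv D1 D2 })
      lift-⊢≣∶ (lam-cong Ad e) Γ′ (lam b1) (lam b2) (`Π A′ B′) refl refl refl refl =
        mapᴱ (lift-⊢Ty Ad Γ′ A′ refl refl && lift-⊢≣∶ e (Γ′ ▸ A′) b1 b2 B′ refl refl refl refl)
          λ { k (D1 , D2) → lam-cong D1 D2 }
      lift-⊢≣∶ (app-cong {A = Aₓ} {B = Bₓ} ef ea) {c} Γ′ (app f1 a1) (app f2 a2) X′ refl refl refl eX
        with liftTy-above c (`Π Aₓ Bₓ)
      ... | d , h , `Π A′ B′ , eP with Π-injective eP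
      ... | eA , eB = pullᴱ h (mapᴱ
            (lift-⊢≣∶ ef (pushCtx h Γ′) (pushTm h f1) (pushTm h f2) (`Π A′ B′) (ιCtx-push h Γ′)
                (ιTm-push h f1) (ιTm-push h f2) eP
             && lift-⊢≣∶ ea (pushCtx h Γ′) (pushTm h a1) (pushTm h a2) A′ (ιCtx-push h Γ′)
                 (ιTm-push h a1) (ιTm-push h a2) eA
             && reflect-≡Ty (pushTy h X′) (B′ [ pushTm h a1 ]₀)
                  (trans (ιTy-push h X′) (trans eX (sym (trans (map-[]₀ (ι d) B′ (pushTm h a1))
                      (cong₂ _[_]₀ eB (ιTm-push h a1)))))))
            λ { k (D1 , D2 , e) → retype-≣ (sym (trans e (map-[]₀ A⟪ k ⟫ B′ (pushTm h a1))))
                (app-cong D1 D2) })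
      lift-⊢≣∶ (pair-cong Ad Bd ea eb) {c} Γ′ (pair a1 b1) (pair a2 b2) (`Σ A′ B′) refl refl refl refl =
        mapᴱ (lift-⊢Ty Ad Γ′ A′ refl refl && lift-⊢Ty Bd (Γ′ ▸ A′) B′ refl refl
              && lift-⊢≣∶ ea Γ′ a1 a2 A′ refl refl refl refl
              && lift-⊢≣∶ eb Γ′ b1 b2 (B′ [ a1 ]₀) refl refl refl (map-[]₀ (ι c) B′ a1))
          λ { k (D1 , D2 , D3 , D4) → pair-cong D1 D2 D3 (retype-≣ (map-[]₀ A⟪ k ⟫ B′ a1) D4) }
      lift-⊢≣∶ (split-cong {A = Aₓ} {B = Bₓ} Ce ce pe) {c} Γ′ (split C1 c1 p1)
          (split C2 c2 p2) X′ refl refl refl eX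
        with liftTy-above c (`Σ Aₓ Bₓ)
      ... | d , h , `Σ A′ B′ , eS with Σ-injective eS
      ... | eA , eB = pullᴱ h (mapᴱ
            (lift-⊢≣Ty Ce (pushCtx h Γ′ ▸ `Σ A′ B′) (pushTy h C1) (pushTy h C2) (cong₂ _▸_
                (ιCtx-push h Γ′) eS) (ιTy-push h C1) (ιTy-push h C2)
             && lift-⊢≣∶ ce (pushCtx h Γ′ ▸ A′ ▸ B′) (pushTm h c1) (pushTm h c2) (subTy
                 (wk2S ∷ₛ pair v1 v0) (pushTy h C1))
                  (cong₂ _▸_ (cong₂ _▸_ (ιCtx-push h Γ′) eA) eB) (ιTm-push h c1) (ιTm-push h c2)
                  (trans (map-splitTy (ι d) (pushTy h C1)) (cong (subTy _) (ιTy-push h C1)))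
             && lift-⊢≣∶ pe (pushCtx h Γ′) (pushTm h p1) (pushTm h p2) (`Σ A′ B′) (ιCtx-push h Γ′)
                 (ιTm-push h p1) (ιTm-push h p2) eS
             && reflect-≡Ty (pushTy h X′) (pushTy h C1 [ pushTm h p1 ]₀)
                  (trans (ιTy-push h X′) (trans eX (sym (trans (map-[]₀ (ι d) (pushTy h C1) (pushTm h p1))
                     (cong₂ _[_]₀ (ιTy-push h C1) (ιTm-push h p1)))))))
            λ { k (D1 , D2 , D3 , e) → retype-≣ (sym (trans e (map-[]₀ A⟪ k ⟫ _ _)))
                  (split-cong D1 (retype-≣ (map-splitTy A⟪ k ⟫ _) D2) D3) })
      lift-⊢≣∶ (rfl-cong e) Γ′ (rfl a1) (rfl a2) (`Id A′ u v) refl refl refl eX with Id-injective eX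
      ... | eA , e1 , e2 =
        mapᴱ (lift-⊢≣∶ e Γ′ a1 a2 A′ refl refl refl eA && reflect-≡Tm u a1 e1 && reflect-≡Tm v a1 e2)
          λ { k (D , p , q) → retype-≣ (cong-Id refl (sym p) (sym q)) (rfl-cong D) }
      lift-⊢≣∶ (J-cong {A = Aₓ} Ce de ae be pe) {c} Γ′ (J C1 d1 a1 b1 p1)
          (J C2 d2 a2 b2 p2) X′ refl refl refl eX
        with liftTy-above c Aₓ
      ... | d , h , A′ , eA = pullᴱ h (mapᴱ
            (lift-⊢≣Ty Ce (JCtx (pushCtx h Γ′) A′) (pushTy h C1) (pushTy h C2) (trans (map-JCtx
                (ι d) _ A′) (cong-JCtx (ιCtx-push h Γ′) eA))
                  (ιTy-push h C1) (ιTy-push h C2)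
             && lift-⊢≣∶ de (pushCtx h Γ′ ▸ A′) (pushTm h d1) (pushTm h d2) (subTy
                 (wkS ∷ₛ v0 ∷ₛ v0 ∷ₛ rfl v0) (pushTy h C1))
                  (cong₂ _▸_ (ιCtx-push h Γ′) eA) (ιTm-push h d1) (ιTm-push h d2) (trans (map-JbaseTy
                      (ι d) _) (cong (subTy _) (ιTy-push h C1)))
             && lift-⊢≣∶ ae (pushCtx h Γ′) (pushTm h a1) (pushTm h a2) A′ (ιCtx-push h Γ′)
                 (ιTm-push h a1) (ιTm-push h a2) eA
             && lift-⊢≣∶ be (pushCtx h Γ′) (pushTm h b1) (pushTm h b2) A′ (ιCtx-push h Γ′)
                 (ιTm-push h b1) (ιTm-push h b2) eA
             && lift-⊢≣∶ pe (pushCtx h Γ′) (pushTm h p1) (pushTm h p2) (`Id A′ (pushTm h a1)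
                 (pushTm h b1)) (ιCtx-push h Γ′) (ιTm-push h p1) (ιTm-push h p2)
                  (cong-Id eA (ιTm-push h a1) (ιTm-push h b1))
             && reflect-≡Ty (pushTy h X′) (subTy (idS ∷ₛ pushTm h a1 ∷ₛ pushTm h b1 ∷ₛ pushTm h p1)
                 (pushTy h C1))
                  (trans (ιTy-push h X′) (trans eX (sym (trans (map-sub₃Ty (ι d) _ _ _ _)
                     (cong-sub₃Ty (ιTy-push h C1) (ιTm-push h a1) (ιTm-push h b1) (ιTm-push h p1)))))))
            λ { k (D1 , D2 , D3 , D4 , D5 , e) → retype-≣ (sym (trans e (map-sub₃Ty A⟪ k ⟫ _ _ _ _)))
                  (J-cong (subst-⊢≣Ty (map-JCtx A⟪ k ⟫ _ _) refl refl D1) (retype-≣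
                      (map-JbaseTy A⟪ k ⟫ _) D2) D3 D4 D5) })
      lift-⊢≣∶ (su-cong e) Γ′ (su a1) (su a2) `ℕ refl refl refl refl =
        mapᴱ (lift-⊢≣∶ e Γ′ a1 a2 `ℕ refl refl refl refl) λ k D → su-cong D
      lift-⊢≣∶ (natrec-cong Ce zq ce ae) {c} Γ′ (natrec C1 z1 c1 a1)
          (natrec C2 z2 c2 a2) X′ refl refl refl eX =
        mapᴱ (lift-⊢≣Ty Ce (Γ′ ▸ `ℕ) C1 C2 refl refl refl
              && lift-⊢≣∶ zq Γ′ z1 z2 (C1 [ ze ]₀) refl refl refl (map-[]₀ (ι c) C1 ze)
              && lift-⊢≣∶ ce (Γ′ ▸ `ℕ ▸ C1) c1 c2 (subTy (wk2S ∷ₛ su v1) C1) refl refl refl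
                  (map-natrecTy (ι c) C1)
              && lift-⊢≣∶ ae Γ′ a1 a2 `ℕ refl refl refl refl
              && reflect-≡Ty X′ (C1 [ a1 ]₀) (trans eX (sym (map-[]₀ (ι c) C1 a1))))
          λ { k (D1 , D2 , D3 , D4 , e) → retype-≣ (sym (trans e (map-[]₀ A⟪ k ⟫ C1 a1)))
                (natrec-cong D1 (retype-≣ (map-[]₀ A⟪ k ⟫ C1 ze) D2) (retype-≣
                    (map-natrecTy A⟪ k ⟫ C1) D3) D4) }
      lift-⊢≣∶ (Π-β {A = Aₓ} {B = Bₓ} Ad bd ad) {c} Γ′ (app (lam b1) a1) r′ X′ refl refl eR eX
        with liftTy-above c (`Π Aₓ Bₓ)
      ... | d , h , `Π A′ B′ , eP with Π-injective eP
      ... | eA , eB = pullᴱ h (mapᴱ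
            (lift-⊢Ty Ad (pushCtx h Γ′) A′ (ιCtx-push h Γ′) eA
             && lift-⊢∶ bd (pushCtx h Γ′ ▸ A′) (pushTm h b1) B′ (cong₂ _▸_ (ιCtx-push h Γ′) eA)
                 (ιTm-push h b1) eB
             && lift-⊢∶ ad (pushCtx h Γ′) (pushTm h a1) A′ (ιCtx-push h Γ′) (ιTm-push h a1) eA
             && reflect-≡Tm (pushTm h r′) (subTm (idS ∷ₛ pushTm h a1) (pushTm h b1))
                  (trans (ιTm-push h r′) (trans eR (sym (trans (map-sub₁Tm (ι d) (pushTm h b1)
                      (pushTm h a1)) (cong-sub₁Tm (ιTm-push h b1) (ιTm-push h a1))))))
             && reflect-≡Ty (pushTy h X′) (B′ [ pushTm h a1 ]₀)
                  (trans (ιTy-push h X′) (trans eX (sym (trans (map-[]₀ (ι d) B′ (pushTm h a1))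
                      (cong₂ _[_]₀ eB (ιTm-push h a1)))))))
            λ { k (D1 , D2 , D3 , er , e) → subst-⊢≣∶ refl refl (sym (trans er (map-sub₁Tm A⟪ k ⟫
                (pushTm h b1) (pushTm h a1))))
                  (sym (trans e (map-[]₀ A⟪ k ⟫ B′ (pushTm h a1)))) (Π-β D1 D2 D3) })
      lift-⊢≣∶ (Π-η fd) Γ′ f1 r′ (`Π A′ B′) refl refl eR refl =
        mapᴱ (lift-⊢∶ fd Γ′ f1 (`Π A′ B′) refl refl refl
              && reflect-≡Tm r′ (lam (app (wkTm f1) v0)) (trans eR (sym (cong (λ u → lam (app u v0))
                  (map-wkTm (ι _) f1)))))
          λ { k (D , e) → subst-⊢≣∶ refl refl (sym (trans e (cong (λ u → lam (app u v0))
              (map-wkTm A⟪ k ⟫ f1)))) refl (Π-η D) }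
      lift-⊢≣∶ (Σ-β {A = Aₓ} {B = Bₓ} Bd Cd cd ad bd) {c} Γ′ (split C1 c1
          (pair a1 b1)) r′ X′ refl refl eR eX
        with liftTy-above c (`Σ Aₓ Bₓ)
      ... | d , h , `Σ A′ B′ , eS with Σ-injective eS
      ... | eA , eB = pullᴱ h (mapᴱ
            (lift-⊢Ty Bd (pushCtx h Γ′ ▸ A′) B′ (cong₂ _▸_ (ιCtx-push h Γ′) eA) eB
             && lift-⊢Ty Cd (pushCtx h Γ′ ▸ `Σ A′ B′) (pushTy h C1) (cong₂ _▸_ (ιCtx-push h Γ′) eS)
                 (ιTy-push h C1)
             && lift-⊢∶ cd (pushCtx h Γ′ ▸ A′ ▸ B′) (pushTm h c1) (subTy (wk2S ∷ₛ pair v1 v0) (pushTy h C1))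
                  (cong₂ _▸_ (cong₂ _▸_ (ιCtx-push h Γ′) eA) eB) (ιTm-push h c1)
                  (trans (map-splitTy (ι d) (pushTy h C1)) (cong (subTy _) (ιTy-push h C1)))
             && lift-⊢∶ ad (pushCtx h Γ′) (pushTm h a1) A′ (ιCtx-push h Γ′) (ιTm-push h a1) eA
             && lift-⊢∶ bd (pushCtx h Γ′) (pushTm h b1) (B′ [ pushTm h a1 ]₀) (ιCtx-push h Γ′)
                 (ιTm-push h b1)
                  (trans (map-[]₀ (ι d) B′ (pushTm h a1)) (cong₂ _[_]₀ eB (ιTm-push h a1)))
             && reflect-≡Tm (pushTm h r′) (subTm (idS ∷ₛ pushTm h a1 ∷ₛ pushTm h b1) (pushTm h c1))
                  (trans (ιTm-push h r′) (trans eR (sym (trans (map-sub₂Tm (ι d) (pushTm h c1)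
                      (pushTm h a1) (pushTm h b1)) (cong-sub₂Tm (ιTm-push h c1) (ιTm-push h a1)
                      (ιTm-push h b1))))))
             && reflect-≡Ty (pushTy h X′) (pushTy h C1 [ pair (pushTm h a1) (pushTm h b1) ]₀)
                  (trans (ιTy-push h X′) (trans eX (sym (trans (map-[]₀ (ι d) (pushTy h C1) (pair
                      (pushTm h a1) (pushTm h b1)))
                     (cong₂ _[_]₀ (ιTy-push h C1) (cong₂ pair (ιTm-push h a1) (ιTm-push h b1))))))))
            λ { k (D1 , D2 , D3 , D4 , D5 , er , e) → subst-⊢≣∶ refl refl (sym (trans er
                (map-sub₂Tm A⟪ k ⟫ (pushTm h c1) (pushTm h a1) (pushTm h b1))))
                  (sym (trans e (map-[]₀ A⟪ k ⟫ _ _)))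
                  (Σ-β D1 D2 (retype-∶ (map-splitTy A⟪ k ⟫ _) D3) D4 (retype-∶ (map-[]₀ A⟪ k ⟫ B′ _) D5)) })
      lift-⊢≣∶ (J-β {A = Aₓ} Cd dd ad) {c} Γ′ (J C1 d1 a1 a2 p1) r′ X′ refl eL eR eX with J-injective eL
      ... | refl , refl , refl , ea2 , ep with liftTy-above c Aₓ
      ... | d , h , A′ , eA = pullᴱ h (mapᴱ
            (lift-⊢Ty Cd (JCtx (pushCtx h Γ′) A′) (pushTy h C1) (trans (map-JCtx (ι d) _ A′) (cong-JCtx
                (ιCtx-push h Γ′) eA)) (ιTy-push h C1)
             && lift-⊢∶ dd (pushCtx h Γ′ ▸ A′) (pushTm h d1) (subTy (wkS ∷ₛ v0 ∷ₛ v0 ∷ₛ rfl v0)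
                 (pushTy h C1))
                  (cong₂ _▸_ (ιCtx-push h Γ′) eA) (ιTm-push h d1) (trans (map-JbaseTy (ι d) _) (cong
                      (subTy _) (ιTy-push h C1)))
             && lift-⊢∶ ad (pushCtx h Γ′) (pushTm h a1) A′ (ιCtx-push h Γ′) (ιTm-push h a1) eA
             && reflect-≡Tm (pushTm h a2) (pushTm h a1) (trans (ιTm-push h a2) (trans ea2 (sym
                 (ιTm-push h a1))))
             && reflect-≡Tm (pushTm h p1) (rfl (pushTm h a1)) (trans (ιTm-push h p1) (trans ep (sym
                 (cong rfl (ιTm-push h a1)))))
             && reflect-≡Tm (pushTm h r′) (subTm (idS ∷ₛ pushTm h a1) (pushTm h d1))
                  (trans (ιTm-push h r′) (trans eR (sym (trans (map-sub₁Tm (ι d) (pushTm h d1)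
                      (pushTm h a1)) (cong-sub₁Tm (ιTm-push h d1) (ιTm-push h a1))))))
             && reflect-≡Ty (pushTy h X′) (subTy (idS ∷ₛ pushTm h a1 ∷ₛ pushTm h a1 ∷ₛ rfl
                 (pushTm h a1)) (pushTy h C1))
                  (trans (ιTy-push h X′) (trans eX (sym (trans (map-sub₃Ty (ι d) _ _ _ _)
                     (cong-sub₃Ty (ιTy-push h C1) (ιTm-push h a1) (ιTm-push h a1) (cong rfl
                         (ιTm-push h a1))))))))
            λ { k (D1 , D2 , D3 , q2 , qp , er , e) →
                  subst-⊢≣∶ refl (cong₂ (λ u w → J _ _ _ u w) (sym q2) (sym qp))
                    (sym (trans er (map-sub₁Tm A⟪ k ⟫ (pushTm h d1) (pushTm h a1))))
                    (sym (trans e (map-sub₃Ty A⟪ k ⟫ _ _ _ _)))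
                    (J-β (subst-⊢Ty (map-JCtx A⟪ k ⟫ _ _) refl D1) (retype-∶
                        (map-JbaseTy A⟪ k ⟫ _) D2) D3) })
      lift-⊢≣∶ (ℕ-β-ze Cd zd cd) {c} Γ′ (natrec C1 z1 c1 ze) r′ X′ refl refl eR eX =
        mapᴱ (lift-⊢Ty Cd (Γ′ ▸ `ℕ) C1 refl refl
              && lift-⊢∶ zd Γ′ z1 (C1 [ ze ]₀) refl refl (map-[]₀ (ι c) C1 ze)
              && lift-⊢∶ cd (Γ′ ▸ `ℕ ▸ C1) c1 (subTy (wk2S ∷ₛ su v1) C1) refl refl (map-natrecTy (ι c) C1)
              && reflect-≡Tm r′ z1 eR
              && reflect-≡Ty X′ (C1 [ ze ]₀) (trans eX (sym (map-[]₀ (ι c) C1 ze))))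
          λ { k (D1 , D2 , D3 , er , e) → subst-⊢≣∶ refl refl (sym er) (sym (trans e
              (map-[]₀ A⟪ k ⟫ C1 ze)))
                (ℕ-β-ze D1 (retype-∶ (map-[]₀ A⟪ k ⟫ C1 ze) D2) (retype-∶ (map-natrecTy A⟪ k ⟫ C1) D3)) }
      lift-⊢≣∶ (ℕ-β-su Cd zd cd ad) {c} Γ′ (natrec C1 z1 c1 (su a1)) r′ X′ refl refl eR eX =
        mapᴱ (lift-⊢Ty Cd (Γ′ ▸ `ℕ) C1 refl refl
              && lift-⊢∶ zd Γ′ z1 (C1 [ ze ]₀) refl refl (map-[]₀ (ι c) C1 ze)
              && lift-⊢∶ cd (Γ′ ▸ `ℕ ▸ C1) c1 (subTy (wk2S ∷ₛ su v1) C1) refl refl (map-natrecTy (ι c) C1)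
              && lift-⊢∶ ad Γ′ a1 `ℕ refl refl refl
              && reflect-≡Tm r′ (subTm (idS ∷ₛ a1 ∷ₛ natrec C1 z1 c1 a1) c1) (trans eR (sym (map-sub₂Tm
                  (ι c) c1 a1 _)))
              && reflect-≡Ty X′ (C1 [ su a1 ]₀) (trans eX (sym (map-[]₀ (ι c) C1 (su a1)))))
          λ { k (D1 , D2 , D3 , D4 , er , e) → subst-⊢≣∶ refl refl (sym (trans er
              (map-sub₂Tm A⟪ k ⟫ c1 a1 _)))
                (sym (trans e (map-[]₀ A⟪ k ⟫ C1 (su a1))))
                (ℕ-β-su D1 (retype-∶ (map-[]₀ A⟪ k ⟫ C1 ze) D2) (retype-∶ (map-natrecTy A⟪ k ⟫ C1) D3) D4) }
      lift-⊢≣∶ (Id-reflect {p = pₓ} pd) {c} Γ′ a2 b2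
          (`Id A′ a1 b1) refl refl refl refl with liftTm-above c pₓ
      ... | d , h , p′ , ep = pullᴱ h (mapᴱ
            (lift-⊢∶ pd (pushCtx h Γ′) p′ (`Id (`Id (pushTy h A′) (pushTm h a1) (pushTm h b1))
                (pushTm h a2) (pushTm h b2))
                 (ιCtx-push h Γ′) ep (cong-Id (cong-Id (ιTy-push h A′) (ιTm-push h a1) (ιTm-push h b1))
                     (ιTm-push h a2) (ιTm-push h b2)))
            λ k D → Id-reflect D)
      lift-⊢≣∶ (const-i g _) {c} Γ′ (const x) (rfl (const y)) X′ refl eL refl eX with const-injective eL
      ... | refl , ex =
        mapᴱ (lift-⊢ g Γ′ refl
              && reflect-≡Cell x (RGSet.i A[ c ] y) (trans ex (sym (RGHom.fun-i (ι c) y)))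
              && reflect-≡Ty X′ (cellTy A[ c ] (RGSet.i A[ c ] y))
                   (trans eX (sym (trans (map-cellTy (ι c) (RGSet.i A[ c ] y))
                     (cong (cellTy A∞) (RGHom.fun-i (ι c) y))))))
          λ { k (D , e1 , e) →
                subst-⊢≣∶ refl (cong const (sym (trans e1 (RGHom.fun-i A⟪ k ⟫ y)))) refl
                  (sym (trans e (trans (map-cellTy A⟪ k ⟫ (RGSet.i A[ c ] y)) (cong (cellTy A[ _ ])
                      (RGHom.fun-i A⟪ k ⟫ y)))))
                  (const-i D (pushCell k y)) }


    WTJ : ∀ {c n} → RFrame A[ c ] n → Judgement c
    WTJ {n = zero} _ = jTrue
    WTJ {n = suc n} (fr , b₀ , b₁) = WTJ fr & jTm ε b₀ (tyR fr) & jTm ε b₁ (tyR fr)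

    WTJ⇒WT : ∀ {c d n} (fr : RFrame A[ c ] n) (h : Hom c d) → ⟦ WTJ fr ⟧ h → WT (mapFrame A⟪ h ⟫ fr)
    WTJ⇒WT {n = zero} _ _ _ = tt
    WTJ⇒WT {n = suc n} (fr , _ , _) h (W , D₀ , D₁) =
      WTJ⇒WT fr h W , retype-∶ (map-tyR A⟪ h ⟫ fr) D₀ , retype-∶ (map-tyR A⟪ h ⟫ fr) D₁

    lift-WT : ∀ {c n} (fr : RFrame A[ c ] n) → WT (mapFrame (ι c) fr) → Eventually (WTJ fr)
    lift-WT {n = zero} _ _ = at idc tt
    lift-WT {c} {suc n} (fr , b₀ , b₁) (W , D₀ , D₁) =
      lift-WT fr W && lift-⊢∶ D₀ ε b₀ (tyR fr) refl refl (map-tyR (ι c) fr)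
                   && lift-⊢∶ D₁ ε b₁ (tyR fr) refl refl (map-tyR (ι c) fr)

    ≈FJ : ∀ {c n} → RFrame A[ c ] n → RFrame A[ c ] n → Judgement c
    ≈FJ {n = zero} _ _ = jTrue
    ≈FJ {n = suc n} (fr , b₀ , b₁) (fr′ , b₀′ , b₁′) =
      ≈FJ fr fr′ & jTmEq ε b₀ b₀′ (tyR fr) & jTmEq ε b₁ b₁′ (tyR fr)

    ≈FJ⇒≈F : ∀ {c d n} (fr fr′ : RFrame A[ c ] n) (h : Hom c d) → ⟦ ≈FJ fr fr′ ⟧ h →
             mapFrame A⟪ h ⟫ fr ≈F mapFrame A⟪ h ⟫ fr′
    ≈FJ⇒≈F {n = zero} _ _ _ _ = tt
    ≈FJ⇒≈F {n = suc n} (fr , _ , _) (fr′ , _ , _) h (E , D₀ , D₁) =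
      ≈FJ⇒≈F fr fr′ h E , retype-≣ (map-tyR A⟪ h ⟫ fr) D₀ , retype-≣ (map-tyR A⟪ h ⟫ fr) D₁

    lift-≈F : ∀ {c n} (fr fr′ : RFrame A[ c ] n) → mapFrame (ι c) fr ≈F mapFrame (ι c) fr′ →
              Eventually (≈FJ fr fr′)
    lift-≈F {n = zero} _ _ _ = at idc tt
    lift-≈F {c} {suc n} (fr , b₀ , b₁) (fr′ , b₀′ , b₁′) (E , D₀ , D₁) =
      lift-≈F fr fr′ E && lift-⊢≣∶ D₀ ε b₀ b₀′ (tyR fr) refl refl refl (map-tyR (ι c) fr)
                       && lift-⊢≣∶ D₁ ε b₁ b₁′ (tyR fr) refl refl refl (map-tyR (ι c) fr)

    T₁ι : ∀ a {n} → T₁Cell A[ a ] n → T₁Cell A∞ n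
    T₁ι a = T₁map (ι a)

    T₁push : ∀ {a b} → Hom a b → ∀ {n} → T₁Cell A[ a ] n → T₁Cell A[ b ] n
    T₁push f = T₁map A⟪ f ⟫

    T₁ι-push : ∀ {a b} (f : Hom a b) {n} (x : T₁Cell A[ a ] n) → T₁ι b (T₁push f x) ≈T T₁ι a x
    T₁ι-push f x@(cell fr _ a _) = ≡⇒≈T (T₁ι _ (T₁push f x)) (T₁ι _ x) (ιFrame-push f fr) (ιTm-push f a)

    opaque
      T₁ι-reflects-≈ : ∀ {c n} (x y : T₁Cell A[ c ] n) → T₁ι c x ≈T T₁ι c y →
                       Σ Obj λ d → Σ (Hom c d) λ h → T₁push h x ≈T T₁push h y
      T₁ι-reflects-≈ {c} (cell fr _ a _) (cell fr′ _ a′ _) (fr≈fr′ , a≣a′)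
        with lift-≈F fr fr′ fr≈fr′ && lift-⊢≣∶ a≣a′ ε a a′ (tyR fr) refl refl refl (map-tyR (ι c) fr)
      ... | at h (E , D) = _ , h , ≈FJ⇒≈F fr fr′ h E , retype-≣ (map-tyR A⟪ h ⟫ fr) D

    CellJ : ∀ {c n} → RFrame A[ c ] n → Tm A[ c ] zero → Judgement c
    CellJ fr a = WTJ fr & jTm ε a (tyR fr)

    cellAt : ∀ {c d n} (fr : RFrame A[ c ] n) (a : Tm A[ c ] zero) (h : Hom c d) →
             ⟦ CellJ fr a ⟧ h → T₁Cell A[ d ] n
    cellAt fr a h (W , D) = cell (mapFrame A⟪ h ⟫ fr) (WTJ⇒WT fr h W) (pushTm h a) (retype-∶ (map-tyR A⟪ h ⟫ fr) D)

    record T₁Preimage {n} (x : T₁Cell A∞ n) : Set where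
      constructor preimage
      field
        stage : Obj
        elem : T₁Cell A[ stage ] n
        ι-elem≈ : T₁ι stage elem ≈T x

    opaque
      T₁-preimage-from : ∀ {d n} (x : T₁Cell A∞ n) (fr′ : RFrame A[ d ] n) (a′ : Tm A[ d ] zero) →
                         mapFrame (ι d) fr′ ≡ T₁Cell.frame x → ιTm d a′ ≡ T₁Cell.term x → T₁Preimage x
      T₁-preimage-from {d} {n} x@(cell _ w _ D) fr′ a′ refl refl
        with lift-WT fr′ w && lift-⊢∶ D ε a′ (tyR fr′) refl refl (map-tyR (ι d) fr′)
      ... | at {e} k holds = preimage e x′ (≡⇒≈T (T₁ι _ x′) x (ιFrame-push k fr′) (ιTm-push k a′))
        where
        x′ : T₁Cell A[ e ] n
        x′ = cellAt fr′ a′ k holds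

      T₁-preimage : ∀ {n} (x : T₁Cell A∞ n) → T₁Preimage x
      T₁-preimage x@(cell fr _ a _) with Frame-inImage fr
      ... | image b fr′ ιfr′≡fr with liftTm-above b a
      ... | _ , h , a′ , ιa′≡a =
        T₁-preimage-from x (mapFrame A⟪ h ⟫ fr′) a′ (trans (ιFrame-push h fr′) ιfr′≡fr) ιa′≡a

    module Universal (Y : SRGSet) (μ : ∀ a → SRGHom (T₁ A[ a ]) Y)
      (μ-compatible : ∀ {a b} (f : Hom a b) {n} (x : T₁Cell A[ a ] n) →
         SRGSet._≈_ Y (SRGHom.fun (μ b) (T₁push f x)) (SRGHom.fun (μ a) x)) where
      private
        module Y = SRGSet Y
        module Y≈ n = Setoid (cellSetoid Y n)

      μ[_] : ∀ a {n} → T₁Cell A[ a ] n → Y.Cell n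
      μ[ a ] = SRGHom.fun (μ a)

      μ-respects-ι : ∀ {a b n} (x : T₁Cell A[ a ] n) (y : T₁Cell A[ b ] n) →
                     T₁ι a x ≈T T₁ι b y → μ[ a ] x Y.≈ μ[ b ] y
      μ-respects-ι {a} {b} {n} x y ιx≈ιy with upper-bound a b
      ... | c , f , g with T₁ι-reflects-≈ (T₁push f x) (T₁push g y) ιfx≈ιgy
        where
        open SetoidReasoning (cellSetoid (T₁ A∞) n)
        ιfx≈ιgy : T₁ι c (T₁push f x) ≈T T₁ι c (T₁push g y)
        ιfx≈ιgy = begin
          T₁ι c (T₁push f x) ≈⟨ T₁ι-push f x ⟩
          T₁ι a x            ≈⟨ ιx≈ιy ⟩
          T₁ι b y            ≈⟨ T₁ι-push g y ⟨
          T₁ι c (T₁push g y) ∎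
      ... | d , h , hfx≈hgy = begin
        μ[ a ] x                         ≈⟨ μ-compatible f x ⟨
        μ[ c ] (T₁push f x)              ≈⟨ μ-compatible h _ ⟨
        μ[ d ] (T₁push h (T₁push f x))   ≈⟨ SRGHom.fun-cong (μ d) hfx≈hgy ⟩
        μ[ d ] (T₁push h (T₁push g y))   ≈⟨ μ-compatible h _ ⟩
        μ[ c ] (T₁push g y)              ≈⟨ μ-compatible g y ⟩
        μ[ b ] y                         ∎
        where open SetoidReasoning (cellSetoid Y n)

      factor : ∀ {n} → T₁Cell A∞ n → Y.Cell n
      factor x = μ[ stage ] elem
        where open T₁Preimage (T₁-preimage x)

      μ≈factor : ∀ {a n} (x : T₁Cell A[ a ] n) {z : T₁Cell A∞ n} → T₁ι a x ≈T z → μ[ a ] x Y.≈ factor z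
      μ≈factor {a} {n} x {z} ιx≈z = μ-respects-ι x elem (begin
        T₁ι a x          ≈⟨ ιx≈z ⟩
        z                ≈⟨ ι-elem≈ ⟨
        T₁ι stage elem   ∎)
        where
        open T₁Preimage (T₁-preimage z)
        open SetoidReasoning (cellSetoid (T₁ A∞) n)

      factor-cong : ∀ {n} {x y : T₁Cell A∞ n} → x ≈T y → factor x Y.≈ factor y
      factor-cong {n} {x} {y} x≈y = μ≈factor elem (begin
        T₁ι stage elem   ≈⟨ ι-elem≈ ⟩
        x                ≈⟨ x≈y ⟩
        y                ∎)
        where
        open T₁Preimage (T₁-preimage x)
        open SetoidReasoning (cellSetoid (T₁ A∞) n)

      factor-natural : ∀ {m n} (op : ∀ {G} → T₁Cell G m → T₁Cell G n) (opY : Y.Cell m → Y.Cell n) →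
                       (∀ {a} (c : T₁Cell A[ a ] m) → T₁ι a (op c) ≈T op (T₁ι a c)) →
                       (∀ {x y : T₁Cell A∞ m} → x ≈T y → op x ≈T op y) →
                       (∀ {a} (c : T₁Cell A[ a ] m) → μ[ a ] (op c) Y.≈ opY (μ[ a ] c)) →
                       ∀ x → factor (op x) Y.≈ opY (factor x)
      factor-natural {n = n} op opY op-ι op-cong op-μ x =
        Y≈.trans n (Y≈.sym n (μ≈factor (op elem) (begin
          T₁ι stage (op elem)   ≈⟨ op-ι elem ⟩
          op (T₁ι stage elem)   ≈⟨ op-cong ι-elem≈ ⟩
          op x                  ∎)))
          (op-μ elem)
        where
        open T₁Preimage (T₁-preimage x)
        open SetoidReasoning (cellSetoid (T₁ A∞) n)

      factorHom : SRGHom (T₁ A∞) Y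
      factorHom = record
        { fun = factor
        ; fun-cong = factor-cong
        ; fun-s = factor-natural T₁s Y.s (SRGHom.fun-s (T₁hom (ι _))) (λ {x} {y} → SRGSet.s-cong (T₁ A∞) {x = x} {y}) (SRGHom.fun-s (μ _))
        ; fun-t = factor-natural T₁t Y.t (SRGHom.fun-t (T₁hom (ι _))) (λ {x} {y} → SRGSet.t-cong (T₁ A∞) {x = x} {y}) (SRGHom.fun-t (μ _))
        ; fun-i = factor-natural T₁i Y.i (SRGHom.fun-i (T₁hom (ι _))) (λ {x} {y} → SRGSet.i-cong (T₁ A∞) {x = x} {y}) (SRGHom.fun-i (μ _)) }

      factor-ι : ∀ a {n} (x : T₁Cell A[ a ] n) → factor (T₁ι a x) Y.≈ μ[ a ] x
      factor-ι a {n} x = Y≈.sym n (μ≈factor x (≈T-refl (T₁ι a x)))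

      factor-unique : (m : SRGHom (T₁ A∞) Y) → (∀ a {n} (x : T₁Cell A[ a ] n) → SRGHom.fun m (T₁ι a x) Y.≈ μ[ a ] x) →
                      ∀ {n} (x : T₁Cell A∞ n) → SRGHom.fun m x Y.≈ factor x
      factor-unique m m-ι {n} x = Y≈.trans n (SRGHom.fun-cong m (Setoid.sym (cellSetoid (T₁ A∞) n) {T₁ι stage elem} {x} ι-elem≈)) (m-ι stage elem)
        where open T₁Preimage (T₁-preimage x)

    T₁-colimit : IsColimit 𝓘 (λ a → T₁ A[ a ]) (λ f → T₁hom A⟪ f ⟫) (T₁ A∞) (λ a → T₁hom (ι a))
    T₁-colimit = record
      { commutes = T₁ι-push
      ; universal = λ Y μ μ-compatible → let open Universal Y μ μ-compatible in
          factorHom , factor-ι , factor-unique }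

lemma6p3 : (𝓘 : Category) → IsFiltered 𝓘 → (A : Functor 𝓘) →
    (A∞ : RGSet) (ι : ∀ a → RGHom (Functor.obj A a) A∞) →
    IsColimit 𝓘 (λ a → disc (Functor.obj A a)) (λ f → discHom (Functor.hom A f))
              (disc A∞) (λ a → discHom (ι a)) →
    IsColimit 𝓘 (λ a → T₁ (Functor.obj A a)) (λ f → T₁hom (Functor.hom A f))
              (T₁ A∞) (λ a → T₁hom (ι a))
lemma6p3 𝓘 filtered A A∞ ι colimit = FilteredDiagram.Colimit.T₁-colimit 𝓘 filtered A A∞ ι colimit
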